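{- Let $X$ be a finite set with $|X|\ge 4$ and let $\tau$ be a non-empty subset of $\binom{X}{3}$. If $\tau$ is thin, then there exists an unrooted caterpillar tree $T$ with leaf set $X$ for which the function ${\rm med}_T:\tau\to \mathring{V}(T)$, $s\mapsto{\rm med}_T(s)$, is one-to-one.
   Context: Let $L(\tau)=\bigcup_{s\in\tau}s$. A non-empty $\tau\subseteq\binom{X}{3}$ is thin if $|L(\tau')|\ge|\tau'|+2$ for every non-empty $\tau'\subseteq\tau$. An unrooted phylogenetic $X$-tree is an unrooted tree with leaf set $X$ (leaves = degree-1 vertices) whose non-leaf vertices are unlabelled with degree at least 3; it is binary if every non-leaf vertex has degree exactly 3. A cherry is a pair of leaves adjacent to a common vertex. An unrooted caterpillar tree on $X$ is an unrooted binary phylogenetic $X$-tree with at most 2 cherries. $\mathring{V}(T)$ is the set of interior (non-leaf) vertices of $T$. For $s=\{x,y,z\}\subseteq X$, ${\rm med}_T(s)$ is the unique vertex of $T$ lying on all three paths between $x,y$, between $x,z$ and between $y,z$. -}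

module Defs where

open import Data.Nat using (ℕ; _≤_; _+_)
open import Data.Fin using (Fin)
open import Data.Fin.Subset using (Subset; _∈_; _∉_; ∣_∣; ⋃; Nonempty)
open import Data.Fin.Subset.Properties using (_∈?_)
open import Data.List using (List; []; _∷_; map; filter; length)
open import Data.List.Relation.Unary.Unique.Propositional using (Unique)
open import Data.List.Membership.Propositional using () renaming (_∈_ to _∈ₗ_)
open import Data.Product using (Σ; ∃; _×_)
open import Data.Empty using (⊥)
open import Relation.Nullary using (¬_)
open import Relation.Binary.PropositionalEquality using (_≡_; _≢_)
open import Function.Definitions using (Injective)
open import Data.List using () renaming (allFin to allFinL)

-- Triple systems on X = Fin n.
-- A collection τ ⊆ (X choose 3) with k elements is an injective family
-- τ : Fin k → Subset n whose members all have cardinality 3.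

-- L(τ') for a sub-collection τ' given as a subset S of the index set Fin k.
L : ∀ {n k} → (Fin k → Subset n) → Subset k → Subset n
L {k = k} τ S = ⋃ (map τ (filter (_∈? S) (allFinL k)))

Thin : ∀ {n k} → (Fin k → Subset n) → Set
Thin {k = k} τ = (S : Subset k) → Nonempty S → ∣ S ∣ + 2 ≤ ∣ L τ S ∣

module GraphNotions {m : ℕ} (adj : Fin m → Subset m) where

  Adj : Fin m → Fin m → Set
  Adj u v = v ∈ adj u

  deg : Fin m → ℕ
  deg v = ∣ adj v ∣

  data Walk : Fin m → Fin m → List (Fin m) → Set where
    here : ∀ v → Walk v v (v ∷ [])
    step : ∀ {u w v vs} → Adj u w → Walk w v vs → Walk u v (u ∷ vs)

  Path : Fin m → Fin m → List (Fin m) → Set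
  Path u v vs = Walk u v vs × Unique vs

  HasCycle : Set
  HasCycle = ∃ λ u → ∃ λ v → ∃ λ vs → Path u v vs × (3 ≤ length vs) × Adj v u

  Connected : Set
  Connected = ∀ u v → ∃ λ vs → Walk u v vs

  -- w lies on the path between u and v (in a tree this path is unique).
  OnPath : Fin m → Fin m → Fin m → Set
  OnPath u v w = ∃ λ vs → Path u v vs × w ∈ₗ vs

record BinaryPhyloTree (n : ℕ) : Set where
  field
    m         : ℕ
    adj       : Fin m → Subset m
  open GraphNotions adj public
  field
    adj-sym   : ∀ u v → Adj u v → Adj v u
    irrefl    : ∀ u → u ∉ adj u
    connected : Connected
    acyclic   : ¬ HasCycle
    leaf      : Fin n → Fin m
    leaf-inj  : Injective _≡_ _≡_ leaf
    leaf-deg  : ∀ x → deg (leaf x) ≡ 1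
    deg1-leaf : ∀ v → deg v ≡ 1 → ∃ λ x → leaf x ≡ v
    binary    : ∀ v → deg v ≢ 1 → deg v ≡ 3

module _ {n : ℕ} (T : BinaryPhyloTree n) where
  open BinaryPhyloTree T

  Cherry : Subset n → Set
  Cherry c = ∣ c ∣ ≡ 2 × ∃ λ w → ∀ x → x ∈ c → Adj w (leaf x)

  Caterpillar : Set
  Caterpillar = ¬ (∃ λ c₁ → ∃ λ c₂ → ∃ λ c₃ →
                   Cherry c₁ × Cherry c₂ × Cherry c₃ ×
                   c₁ ≢ c₂ × c₁ ≢ c₃ × c₂ ≢ c₃)

  IsMed : Subset n → Fin m → Set
  IsMed s v = ∀ x y → x ∈ s → y ∈ s → x ≢ y → OnPath (leaf x) (leaf y) v

  MedInjective : ∀ {k} → (Fin k → Subset n) → Set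
  MedInjective {k} τ = ∀ (i j : Fin k) (v : Fin m) → IsMed (τ i) v → IsMed (τ j) v → i ≡ j

module Submission where

-- Order X greedily. With Y the set of elements not yet placed, place next an
-- x ∈ Y that becomes the middle (one element already placed, one still in
-- Y ∖ x) of at most one triple. Such an x exists, and Y ∖ x inherits the
-- condition, as long as |L(F) ∩ Y| ≥ |F| + 1 for every non-empty family F of
-- triples meeting Y in at least two elements; for Y = X this is thinness. The
-- element is found by descending along maximal tight families ("obstructions"),
-- using that tight families sharing an element of Y have a tight union.
-- Hence distinct triples have distinct middle elements. In the caterpillar
-- whose leaves hang along the spine in this order, the median of a triple is
-- the spine vertex carrying its middle leaf, and the middle positions
-- 1, …, n - 2 are carried by distinct spine vertices.

open import Defs
open import Data.Nat using (ℕ; _≤_)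
open import Data.Fin using (Fin)
open import Data.Fin.Subset using (Subset; ∣_∣)
open import Data.Product using (∃; _×_)
open import Relation.Binary.PropositionalEquality using (_≡_)
open import Function.Definitions using (Injective)

open import Data.Nat using (zero; suc; _+_; _∸_; _⊓_; _<_; z≤n; s≤s; _<?_; _≤?_) renaming (_≟_ to _≟ℕ_)
open import Data.Nat.Properties
open import Data.Bool using (true; false)
open import Data.Fin using (zero; suc; toℕ; fromℕ<) renaming (_≟_ to _≟F_)
open import Data.Fin.Properties using (any?; all?; ¬∀⟶∃¬; toℕ-injective; toℕ-fromℕ<; toℕ<n)
open import Data.Fin.Subset
  using (_∈_; _∉_; _⊆_; _⊂_; _∪_; _∩_; _─_; _-_; ⁅_⁆; ⊤; ⋃; Nonempty; Empty)
open import Data.Fin.Subset.Properties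
open import Data.Vec using ([]; _∷_; tabulate; _[_]=_)
open _[_]=_ using (here; there)
open import Data.Vec.Properties using ([]=⇒lookup; lookup⇒[]=; lookup∘tabulate)
open import Data.List using (List; []; _∷_; length; map; filter; allFin)
open import Data.List.Relation.Unary.Any using (here; there)
open import Data.List.Membership.Propositional using () renaming (_∈_ to _∈ₗ_)
open import Data.List.Membership.Propositional.Properties using (∈-map⁻; ∈-map⁺; ∈-filter⁻; ∈-filter⁺; ∈-allFin)
open import Data.List.Relation.Unary.Unique.Propositional using (Unique)
open import Data.List.Relation.Unary.AllPairs using (_∷_; []; tail)
open import Data.List.Relation.Unary.Unique.Propositional.Properties using (Unique[x∷xs]⇒x∉xs)
import Data.List.Relation.Unary.All as All
open import Data.Product using (Σ; ∃₂; _,_; proj₁; proj₂)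
open import Data.Sum using (_⊎_; inj₁; inj₂; [_,_]′)
open import Data.Empty using (⊥; ⊥-elim)
open import Relation.Nullary using (¬_; Dec; yes; no; does)
open import Relation.Nullary.Decidable using (_×-dec_; _⊎-dec_; _→-dec_; ¬?; dec-true)
open import Relation.Binary using (tri<; tri≈; tri>; DecidableEquality)
open import Function using (_∘_)
open import Induction.WellFounded using (Acc; acc)
open import Data.Nat.Induction using (<-wellFounded)
open import Relation.Binary.PropositionalEquality using (_≢_; refl; sym; trans; cong; subst; module ≡-Reasoning)

-- Cardinalities of finite subsets

∣p∪q∣+∣p∩q∣≡∣p∣+∣q∣ : ∀ {n} (p q : Subset n) → ∣ p ∪ q ∣ + ∣ p ∩ q ∣ ≡ ∣ p ∣ + ∣ q ∣
∣p∪q∣+∣p∩q∣≡∣p∣+∣q∣ [] [] = refl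
∣p∪q∣+∣p∩q∣≡∣p∣+∣q∣ (true ∷ p) (true ∷ q) = cong suc (begin
  ∣ p ∪ q ∣ + suc ∣ p ∩ q ∣ ≡⟨ +-suc ∣ p ∪ q ∣ ∣ p ∩ q ∣ ⟩
  suc (∣ p ∪ q ∣ + ∣ p ∩ q ∣) ≡⟨ cong suc (∣p∪q∣+∣p∩q∣≡∣p∣+∣q∣ p q) ⟩
  suc (∣ p ∣ + ∣ q ∣) ≡⟨ +-suc ∣ p ∣ ∣ q ∣ ⟨
  ∣ p ∣ + suc ∣ q ∣ ∎)
  where open ≡-Reasoning
∣p∪q∣+∣p∩q∣≡∣p∣+∣q∣ (true ∷ p) (false ∷ q) = cong suc (∣p∪q∣+∣p∩q∣≡∣p∣+∣q∣ p q)
∣p∪q∣+∣p∩q∣≡∣p∣+∣q∣ (false ∷ p) (true ∷ q) =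
  trans (cong suc (∣p∪q∣+∣p∩q∣≡∣p∣+∣q∣ p q)) (sym (+-suc ∣ p ∣ ∣ q ∣))
∣p∪q∣+∣p∩q∣≡∣p∣+∣q∣ (false ∷ p) (false ∷ q) = ∣p∪q∣+∣p∩q∣≡∣p∣+∣q∣ p q

module _ {n : ℕ} where

  ∣p∪q∣≤∣p∣+∣q∣ : (p q : Subset n) → ∣ p ∪ q ∣ ≤ ∣ p ∣ + ∣ q ∣
  ∣p∪q∣≤∣p∣+∣q∣ p q = subst (∣ p ∪ q ∣ ≤_) (∣p∪q∣+∣p∩q∣≡∣p∣+∣q∣ p q) (m≤m+n _ _)

  Empty[p∩q]⇒∣p∪q∣≡∣p∣+∣q∣ : (p q : Subset n) → Empty (p ∩ q) → ∣ p ∪ q ∣ ≡ ∣ p ∣ + ∣ q ∣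
  Empty[p∩q]⇒∣p∪q∣≡∣p∣+∣q∣ p q empty = begin
    ∣ p ∪ q ∣ ≡⟨ +-identityʳ _ ⟨
    ∣ p ∪ q ∣ + 0 ≡⟨ cong (∣ p ∪ q ∣ +_) (trans (cong ∣_∣ (Empty-unique empty)) (∣⊥∣≡0 n)) ⟨
    ∣ p ∪ q ∣ + ∣ p ∩ q ∣ ≡⟨ ∣p∪q∣+∣p∩q∣≡∣p∣+∣q∣ p q ⟩
    ∣ p ∣ + ∣ q ∣ ∎
    where open ≡-Reasoning

  x∉p⇒∣p∪⁅x⁆∣≡1+∣p∣ : ∀ (p : Subset n) {x} → x ∉ p → ∣ p ∪ ⁅ x ⁆ ∣ ≡ suc ∣ p ∣
  x∉p⇒∣p∪⁅x⁆∣≡1+∣p∣ p {x} x∉p = begin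
    ∣ p ∪ ⁅ x ⁆ ∣ ≡⟨ Empty[p∩q]⇒∣p∪q∣≡∣p∣+∣q∣ p ⁅ x ⁆ disjoint ⟩
    ∣ p ∣ + ∣ ⁅ x ⁆ ∣ ≡⟨ cong (∣ p ∣ +_) (∣⁅x⁆∣≡1 x) ⟩
    ∣ p ∣ + 1 ≡⟨ +-comm ∣ p ∣ 1 ⟩
    suc ∣ p ∣ ∎
    where
    open ≡-Reasoning
    disjoint : Empty (p ∩ ⁅ x ⁆)
    disjoint (y , y∈) with x∈p∩q⁻ p ⁅ x ⁆ y∈
    ... | y∈p , y∈⁅x⁆ = x∉p (subst (_∈ p) (x∈⁅y⁆⇒x≡y x y∈⁅x⁆) y∈p)

  ∣p∪⁅x⁆∣≤1+∣p∣ : ∀ (p : Subset n) x → ∣ p ∪ ⁅ x ⁆ ∣ ≤ suc ∣ p ∣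
  ∣p∪⁅x⁆∣≤1+∣p∣ p x = ≤-trans (∣p∪q∣≤∣p∣+∣q∣ p ⁅ x ⁆)
    (≤-reflexive (trans (cong (∣ p ∣ +_) (∣⁅x⁆∣≡1 x)) (+-comm ∣ p ∣ 1)))

  p⊆q∪⁅x⁆⇒∣p∣≤1+∣q∣ : ∀ {p q : Subset n} {x} → p ⊆ q ∪ ⁅ x ⁆ → ∣ p ∣ ≤ suc ∣ q ∣
  p⊆q∪⁅x⁆⇒∣p∣≤1+∣q∣ {q = q} {x} p⊆ = ≤-trans (p⊆q⇒∣p∣≤∣q∣ p⊆) (∣p∪⁅x⁆∣≤1+∣p∣ q x)

  p⊆[p-x]∪⁅x⁆ : ∀ (p : Subset n) x → p ⊆ (p - x) ∪ ⁅ x ⁆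
  p⊆[p-x]∪⁅x⁆ p x {y} y∈p with y ≟F x
  ... | yes refl = x∈p∪q⁺ (inj₂ (x∈⁅x⁆ y))
  ... | no y≢x = x∈p∪q⁺ (inj₁ (x∈p∧x≢y⇒x∈p-y y∈p y≢x))

  x∈p⇒1+∣p-x∣≡∣p∣ : ∀ {p : Subset n} {x} → x ∈ p → suc ∣ p - x ∣ ≡ ∣ p ∣
  x∈p⇒1+∣p-x∣≡∣p∣ {p} {x} x∈p = ≤-antisym (x∈p⇒∣p-x∣<∣p∣ x∈p) (p⊆q∪⁅x⁆⇒∣p∣≤1+∣q∣ (p⊆[p-x]∪⁅x⁆ p x))

  x∈p─q⁻ : ∀ {p q : Subset n} {x} → x ∈ p ─ q → x ∈ p × x ∉ q
  x∈p─q⁻ {p} {q} x∈ = p─q⊆p p q x∈ , ∉q x∈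
    where
    ∉q : ∀ {k} {p q : Subset k} {x} → x ∈ p ─ q → x ∉ q
    ∉q {p = true ∷ p} {true ∷ q} () here
    ∉q {p = _ ∷ p} {_ ∷ q} (there x∈) (there x∈q) = ∉q x∈ x∈q

  x∈p-y⁻ : ∀ {p : Subset n} {x y} → x ∈ p - y → x ∈ p × x ≢ y
  x∈p-y⁻ x∈ with x∈p─q⁻ x∈
  ... | x∈p , x∉⁅y⁆ = x∈p , x∉⁅y⁆⇒x≢y x∉⁅y⁆

  p⊈q⇒∃ : ∀ {p q : Subset n} → ¬ p ⊆ q → ∃ λ x → x ∈ p × x ∉ q
  p⊈q⇒∃ {p} {q} p⊈q with ¬∀⟶∃¬ n _ (λ x → (x ∈? p) →-dec (x ∈? q)) (λ ∀x → p⊈q (∀x _))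
  ... | x , ¬[x∈p→x∈q] with x ∈? p | x ∈? q
  ... | yes x∈p | no x∉q = x , x∈p , x∉q
  ... | yes _ | yes x∈q = ⊥-elim (¬[x∈p→x∈q] (λ _ → x∈q))
  ... | no x∉p | _ = ⊥-elim (¬[x∈p→x∈q] (λ x∈p → ⊥-elim (x∉p x∈p)))

  p⊆q⇒∣q∣≤∣p∣⇒p≡q : ∀ {p q : Subset n} → p ⊆ q → ∣ q ∣ ≤ ∣ p ∣ → p ≡ q
  p⊆q⇒∣q∣≤∣p∣⇒p≡q {p} {q} p⊆q ∣q∣≤∣p∣ with q ⊆? p
  ... | yes q⊆p = ⊆-antisym p⊆q q⊆p
  ... | no q⊈p with p⊈q⇒∃ q⊈p
  ...   | x , x∈q , x∉p = ⊥-elim (<⇒≱ (p⊂q⇒∣p∣<∣q∣ (p⊆q , x , x∈q , x∉p)) ∣q∣≤∣p∣)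

  x∈p⇒1≤∣p∣ : ∀ {p : Subset n} {x} → x ∈ p → 1 ≤ ∣ p ∣
  x∈p⇒1≤∣p∣ {p} {x} x∈p = subst (_≤ ∣ p ∣) (∣⁅x⁆∣≡1 x) (p⊆q⇒∣p∣≤∣q∣ ⁅x⁆⊆p)
    where
    ⁅x⁆⊆p : ⁅ x ⁆ ⊆ p
    ⁅x⁆⊆p y∈⁅x⁆ = subst (_∈ p) (sym (x∈⁅y⁆⇒x≡y x y∈⁅x⁆)) x∈p

  1≤∣p∣⇒Nonempty : ∀ (p : Subset n) → 1 ≤ ∣ p ∣ → Nonempty p
  1≤∣p∣⇒Nonempty p 1≤∣p∣ with nonempty? p
  ... | yes ne = ne
  ... | no empty = ⊥-elim (<⇒≱ 1≤∣p∣ (≤-reflexive (trans (cong ∣_∣ (Empty-unique empty)) (∣⊥∣≡0 n))))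

  ∈⁅x⁆∪⁅y⁆⁻ : ∀ {x y z : Fin n} → z ∈ ⁅ x ⁆ ∪ ⁅ y ⁆ → z ≡ x ⊎ z ≡ y
  ∈⁅x⁆∪⁅y⁆⁻ {x} {y} z∈ with x∈p∪q⁻ ⁅ x ⁆ ⁅ y ⁆ z∈
  ... | inj₁ z∈⁅x⁆ = inj₁ (x∈⁅y⁆⇒x≡y x z∈⁅x⁆)
  ... | inj₂ z∈⁅y⁆ = inj₂ (x∈⁅y⁆⇒x≡y y z∈⁅y⁆)

  ⁅x⁆∪⁅y⁆⊆p : ∀ {p : Subset n} {x y} → x ∈ p → y ∈ p → ⁅ x ⁆ ∪ ⁅ y ⁆ ⊆ p
  ⁅x⁆∪⁅y⁆⊆p {p} x∈p y∈p z∈ with ∈⁅x⁆∪⁅y⁆⁻ z∈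
  ... | inj₁ refl = x∈p
  ... | inj₂ refl = y∈p

  ∣⁅x⁆∪⁅y⁆∣≡2 : ∀ {x y : Fin n} → x ≢ y → ∣ ⁅ x ⁆ ∪ ⁅ y ⁆ ∣ ≡ 2
  ∣⁅x⁆∪⁅y⁆∣≡2 {x} {y} x≢y =
    trans (x∉p⇒∣p∪⁅x⁆∣≡1+∣p∣ ⁅ x ⁆ (λ y∈⁅x⁆ → x≢y (sym (x∈⁅y⁆⇒x≡y x y∈⁅x⁆)))) (cong suc (∣⁅x⁆∣≡1 x))

  ∣⁅x⁆∪⁅y⁆∣≤2 : ∀ (x y : Fin n) → ∣ ⁅ x ⁆ ∪ ⁅ y ⁆ ∣ ≤ 2
  ∣⁅x⁆∪⁅y⁆∣≤2 x y = ≤-trans (∣p∪⁅x⁆∣≤1+∣p∣ ⁅ x ⁆ y) (≤-reflexive (cong suc (∣⁅x⁆∣≡1 x)))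

  2≤∣p∣⇒∃₂≢ : ∀ (p : Subset n) → 2 ≤ ∣ p ∣ → ∃₂ λ x y → x ∈ p × y ∈ p × x ≢ y
  2≤∣p∣⇒∃₂≢ p 2≤∣p∣ with 1≤∣p∣⇒Nonempty p (≤-trans (n≤1+n 1) 2≤∣p∣)
  ... | x , x∈p with 1≤∣p∣⇒Nonempty (p - x) (≤-pred (≤-trans 2≤∣p∣ (p⊆q∪⁅x⁆⇒∣p∣≤1+∣q∣ (p⊆[p-x]∪⁅x⁆ p x))))
  ...   | y , y∈p-x with x∈p-y⁻ y∈p-x
  ...     | y∈p , y≢x = x , y , x∈p , y∈p , λ x≡y → y≢x (sym x≡y)

  ∈∧∈∧≢⇒2≤∣p∣ : ∀ {p : Subset n} {x y} → x ∈ p → y ∈ p → x ≢ y → 2 ≤ ∣ p ∣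
  ∈∧∈∧≢⇒2≤∣p∣ {p} {x} {y} x∈p y∈p x≢y = subst (_< ∣ p ∣) (∣⁅x⁆∣≡1 x)
    (p⊂q⇒∣p∣<∣q∣ (⁅x⁆⊆p , y , y∈p , λ y∈⁅x⁆ → x≢y (sym (x∈⁅y⁆⇒x≡y x y∈⁅x⁆))))
    where
    ⁅x⁆⊆p : ⁅ x ⁆ ⊆ p
    ⁅x⁆⊆p z∈⁅x⁆ = subst (_∈ p) (sym (x∈⁅y⁆⇒x≡y x z∈⁅x⁆)) x∈p

  ∈∧∈∧∈∧≢⇒3≤∣p∣ : ∀ {p : Subset n} {x y z} → x ∈ p → y ∈ p → z ∈ p → x ≢ y → x ≢ z → y ≢ z → 3 ≤ ∣ p ∣
  ∈∧∈∧∈∧≢⇒3≤∣p∣ {p} x∈p y∈p z∈p x≢y x≢z y≢z = subst (_< ∣ p ∣) (∣⁅x⁆∪⁅y⁆∣≡2 x≢y)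
    (p⊂q⇒∣p∣<∣q∣ (⁅x⁆∪⁅y⁆⊆p x∈p y∈p , _ , z∈p , z∉))
    where
    z∉ : _ ∉ ⁅ _ ⁆ ∪ ⁅ _ ⁆
    z∉ z∈ = [ (λ z≡x → x≢z (sym z≡x)) , (λ z≡y → y≢z (sym z≡y)) ]′ (∈⁅x⁆∪⁅y⁆⁻ z∈)

  ∣p∣≤2⇒∈⇒≡⊎≡ : ∀ {p : Subset n} {x y z} → ∣ p ∣ ≤ 2 → x ∈ p → y ∈ p → x ≢ y → z ∈ p → z ≡ x ⊎ z ≡ y
  ∣p∣≤2⇒∈⇒≡⊎≡ {z = z} ∣p∣≤2 x∈p y∈p x≢y z∈p with z ≟F _ | z ≟F _
  ... | yes z≡x | _ = inj₁ z≡x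
  ... | no _ | yes z≡y = inj₂ z≡y
  ... | no z≢x | no z≢y = ⊥-elim (<⇒≱ (s≤s ∣p∣≤2)
        (∈∧∈∧∈∧≢⇒3≤∣p∣ x∈p y∈p z∈p x≢y (λ e → z≢x (sym e)) (λ e → z≢y (sym e))))

  ∣p∣≡3⇒∃₃≢ : ∀ (p : Subset n) → ∣ p ∣ ≡ 3 →
              ∃ λ x → ∃ λ y → ∃ λ z → x ∈ p × y ∈ p × z ∈ p × x ≢ y × x ≢ z × y ≢ z
  ∣p∣≡3⇒∃₃≢ p ∣p∣≡3 with 2≤∣p∣⇒∃₂≢ p (≤-trans (n≤1+n 2) (≤-reflexive (sym ∣p∣≡3)))
  ... | x , y , x∈p , y∈p , x≢y with any? (λ z → (z ∈? p) ×-dec ¬? (z ≟F x) ×-dec ¬? (z ≟F y))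
  ...   | yes (z , z∈p , z≢x , z≢y) = x , y , z , x∈p , y∈p , z∈p , x≢y , (λ e → z≢x (sym e)) , (λ e → z≢y (sym e))
  ...   | no ∄z = ⊥-elim (<⇒≱ (≤-reflexive (sym ∣p∣≡3)) (≤-trans (p⊆q⇒∣p∣≤∣q∣ p⊆) (∣⁅x⁆∪⁅y⁆∣≤2 x y)))
    where
    p⊆ : p ⊆ ⁅ x ⁆ ∪ ⁅ y ⁆
    p⊆ {z} z∈p with z ≟F x | z ≟F y
    ... | yes refl | _ = x∈p∪q⁺ (inj₁ (x∈⁅x⁆ z))
    ... | no _ | yes refl = x∈p∪q⁺ (inj₂ (x∈⁅x⁆ z))
    ... | no z≢x | no z≢y = ⊥-elim (∄z (z , z∈p , z≢x , z≢y))

-- Orderings of X in which distinct triples have distinct middles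

x∈⋃⁻ : ∀ {n} {x : Fin n} (ps : List (Subset n)) → x ∈ ⋃ ps → ∃ λ p → p ∈ₗ ps × x ∈ p
x∈⋃⁻ [] x∈ = ⊥-elim (∉⊥ x∈)
x∈⋃⁻ (p ∷ ps) x∈ with x∈p∪q⁻ p (⋃ ps) x∈
... | inj₁ x∈p = p , here refl , x∈p
... | inj₂ x∈⋃ps with x∈⋃⁻ ps x∈⋃ps
...   | q , q∈ps , x∈q = q , there q∈ps , x∈q

x∈⋃⁺ : ∀ {n} {x : Fin n} {p} (ps : List (Subset n)) → p ∈ₗ ps → x ∈ p → x ∈ ⋃ ps
x∈⋃⁺ (q ∷ ps) (here refl) x∈p = x∈p∪q⁺ (inj₁ x∈p)
x∈⋃⁺ (q ∷ ps) (there p∈ps) x∈p = x∈p∪q⁺ (inj₂ (x∈⋃⁺ ps p∈ps x∈p))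

module _ {n k : ℕ} (τ : Fin k → Subset n) where

  x∈L⁻ : ∀ {F x} → x ∈ L τ F → ∃ λ i → i ∈ F × x ∈ τ i
  x∈L⁻ {F} x∈ with x∈⋃⁻ (map τ (filter (_∈? F) (allFin k))) x∈
  ... | p , p∈ , x∈p with ∈-map⁻ τ p∈
  ...   | i , i∈ , refl = i , proj₂ (∈-filter⁻ (_∈? F) {xs = allFin k} i∈) , x∈p

  x∈L⁺ : ∀ {F x i} → i ∈ F → x ∈ τ i → x ∈ L τ F
  x∈L⁺ {F} {i = i} i∈F =
    x∈⋃⁺ (map τ (filter (_∈? F) (allFin k))) (∈-map⁺ τ (∈-filter⁺ (_∈? F) (∈-allFin i) i∈F))

  L-mono : ∀ {F G} → F ⊆ G → L τ F ⊆ L τ G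
  L-mono F⊆G x∈ with x∈L⁻ x∈
  ... | i , i∈F , x∈τi = x∈L⁺ (F⊆G i∈F) x∈τi

  L∩-mono : ∀ {Y F G} → F ⊆ G → L τ F ∩ Y ⊆ L τ G ∩ Y
  L∩-mono {Y} {F} F⊆G x∈ with x∈p∩q⁻ (L τ F) Y x∈
  ... | x∈L , x∈Y = x∈p∩q⁺ (L-mono F⊆G x∈L , x∈Y)

  x∈L⁅i⁆⇒x∈τi : ∀ {x} i → x ∈ L τ ⁅ i ⁆ → x ∈ τ i
  x∈L⁅i⁆⇒x∈τi i x∈ with x∈L⁻ x∈
  ... | j , j∈⁅i⁆ , x∈τj = subst (λ t → _ ∈ τ t) (x∈⁅y⁆⇒x≡y i j∈⁅i⁆) x∈τj

Precedes : ∀ {A : Set} → List A → A → A → Set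
Precedes [] a b = ⊥
Precedes (x ∷ l) a b = (a ≡ x × b ∈ₗ l) ⊎ Precedes l a b

Precedes⇒∈ˡ : ∀ {A : Set} (l : List A) {a b} → Precedes l a b → a ∈ₗ l
Precedes⇒∈ˡ (x ∷ l) (inj₁ (refl , _)) = here refl
Precedes⇒∈ˡ (x ∷ l) (inj₂ a≺b) = there (Precedes⇒∈ˡ l a≺b)

Precedes⇒∈ʳ : ∀ {A : Set} (l : List A) {a b} → Precedes l a b → b ∈ₗ l
Precedes⇒∈ʳ (x ∷ l) (inj₁ (_ , b∈l)) = there b∈l
Precedes⇒∈ʳ (x ∷ l) (inj₂ a≺b) = there (Precedes⇒∈ʳ l a≺b)

module Ordering {n k : ℕ} (τ : Fin k → Subset n) (∣τ∣≡3 : ∀ i → ∣ τ i ∣ ≡ 3) (thin : Thin τ) where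

  Live : Subset n → Fin k → Set
  Live Y i = 2 ≤ ∣ τ i ∩ Y ∣

  AllLive : Subset n → Subset k → Set
  AllLive Y F = ∀ i → i ∈ F → Live Y i

  ThinIn : Subset n → Set
  ThinIn Y = ∀ F → Nonempty F → AllLive Y F → suc ∣ F ∣ ≤ ∣ L τ F ∩ Y ∣

  Tight : Subset n → Subset k → Set
  Tight Y F = Nonempty F × AllLive Y F × ∣ L τ F ∩ Y ∣ ≤ suc ∣ F ∣

  Straddles : Subset n → Fin k → Set
  Straddles Y i = Live Y i × ¬ τ i ⊆ Y

  StraddlesAt : Subset n → Fin k → Fin n → Fin n → Set
  StraddlesAt Y i z w = z ∈ τ i ∩ Y × w ∈ τ i ∩ Y × z ≢ w × (∀ u → u ∈ τ i ∩ Y → u ≡ z ⊎ u ≡ w)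

  -- Y is the set of elements not yet placed: placing x next makes it the
  -- middle of τ i.
  MiddleNext : Subset n → Fin n → Fin k → Set
  MiddleNext Y x i = x ∈ τ i × (∃ λ a → a ∈ τ i × a ∉ Y) × (∃ λ c → c ∈ τ i × c ∈ Y × c ≢ x)

  Eligible : Subset n → Fin n → Set
  Eligible Y x = x ∈ Y × (∀ i j → MiddleNext Y x i → MiddleNext Y x j → i ≡ j) × ThinIn (Y - x)

  Obstruction : Subset n → Fin n → Fin k → Subset k → Set
  Obstruction Y x q F = Tight Y F × q ∉ F × x ∈ L τ F ∩ Y

  Obstructed : Subset n → Fin n → Fin k → Set
  Obstructed Y x q = ∃ (Obstruction Y x q)

  MaximalObstruction : Subset n → Fin n → Fin k → Subset k → Set
  MaximalObstruction Y x q F = Obstruction Y x q F × (∀ H → Obstruction Y x q H → H ⊆ F)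

  Live? : ∀ Y i → Dec (Live Y i)
  Live? Y i = 2 ≤? ∣ τ i ∩ Y ∣

  AllLive? : ∀ Y F → Dec (AllLive Y F)
  AllLive? Y F = all? (λ i → (i ∈? F) →-dec Live? Y i)

  Straddles? : ∀ Y i → Dec (Straddles Y i)
  Straddles? Y i = Live? Y i ×-dec ¬? (τ i ⊆? Y)

  Tight? : ∀ Y F → Dec (Tight Y F)
  Tight? Y F = nonempty? F ×-dec AllLive? Y F ×-dec (∣ L τ F ∩ Y ∣ ≤? suc ∣ F ∣)

  Obstruction? : ∀ Y x q F → Dec (Obstruction Y x q F)
  Obstruction? Y x q F = Tight? Y F ×-dec ¬? (q ∈? F) ×-dec (x ∈? L τ F ∩ Y)

  Obstructed? : ∀ Y x q → Dec (Obstructed Y x q)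
  Obstructed? Y x q = anySubset? (Obstruction? Y x q)

  ⊈⇒∣τi∩Y∣≤2 : ∀ {Y} i → ¬ τ i ⊆ Y → ∣ τ i ∩ Y ∣ ≤ 2
  ⊈⇒∣τi∩Y∣≤2 {Y} i τi⊈Y with p⊈q⇒∃ τi⊈Y
  ... | y , y∈τi , y∉Y = ≤-pred (begin-strict
    ∣ τ i ∩ Y ∣ ≤⟨ p⊆q⇒∣p∣≤∣q∣ τi∩Y⊆τi-y ⟩
    ∣ τ i - y ∣ <⟨ x∈p⇒∣p-x∣<∣p∣ y∈τi ⟩
    ∣ τ i ∣ ≡⟨ ∣τ∣≡3 i ⟩
    3 ∎)
    where
    open ≤-Reasoning
    τi∩Y⊆τi-y : τ i ∩ Y ⊆ τ i - y
    τi∩Y⊆τi-y {u} u∈ with x∈p∩q⁻ (τ i) Y u∈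
    ... | u∈τi , u∈Y = x∈p∧x≢y⇒x∈p-y u∈τi (λ u≡y → y∉Y (subst (_∈ Y) u≡y u∈Y))

  Straddles⇒∃StraddlesAt : ∀ {Y i} → Straddles Y i → ∃₂ (StraddlesAt Y i)
  Straddles⇒∃StraddlesAt {Y} {i} (live , τi⊈Y) with 2≤∣p∣⇒∃₂≢ (τ i ∩ Y) live
  ... | z , w , z∈ , w∈ , z≢w = z , w , z∈ , w∈ , z≢w , λ u → ∣p∣≤2⇒∈⇒≡⊎≡ (⊈⇒∣τi∩Y∣≤2 i τi⊈Y) z∈ w∈ z≢w

  Straddles⇒Tight⁅⁆ : ∀ {Y i} → Straddles Y i → Tight Y ⁅ i ⁆
  Straddles⇒Tight⁅⁆ {Y} {i} (live , τi⊈Y) = (i , x∈⁅x⁆ i) , live⁅i⁆ , (begin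
    ∣ L τ ⁅ i ⁆ ∩ Y ∣ ≤⟨ p⊆q⇒∣p∣≤∣q∣ L⁅i⁆∩Y⊆τi∩Y ⟩
    ∣ τ i ∩ Y ∣ ≤⟨ ⊈⇒∣τi∩Y∣≤2 i τi⊈Y ⟩
    2 ≡⟨ cong suc (∣⁅x⁆∣≡1 i) ⟨
    suc ∣ ⁅ i ⁆ ∣ ∎)
    where
    open ≤-Reasoning
    live⁅i⁆ : AllLive Y ⁅ i ⁆
    live⁅i⁆ j j∈⁅i⁆ = subst (Live Y) (sym (x∈⁅y⁆⇒x≡y i j∈⁅i⁆)) live
    L⁅i⁆∩Y⊆τi∩Y : L τ ⁅ i ⁆ ∩ Y ⊆ τ i ∩ Y
    L⁅i⁆∩Y⊆τi∩Y u∈ with x∈p∩q⁻ _ Y u∈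
    ... | u∈L , u∈Y = x∈p∩q⁺ (x∈L⁅i⁆⇒x∈τi τ i u∈L , u∈Y)

  -- Here thinness of τ itself is used: a tight family cannot lie inside Y.
  Tight⇒∃Straddles : ∀ {Y F} → Tight Y F → ∃ λ i → i ∈ F × Straddles Y i
  Tight⇒∃Straddles {Y} {F} (ne , live , tight) with all? (λ i → (i ∈? F) →-dec (τ i ⊆? Y))
  ... | yes all⊆ = ⊥-elim (<⇒≱ (s≤s tight) (begin
    2 + ∣ F ∣ ≡⟨ +-comm 2 ∣ F ∣ ⟩
    ∣ F ∣ + 2 ≤⟨ thin F ne ⟩
    ∣ L τ F ∣ ≤⟨ p⊆q⇒∣p∣≤∣q∣ LF⊆LF∩Y ⟩
    ∣ L τ F ∩ Y ∣ ∎))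
    where
    open ≤-Reasoning
    LF⊆LF∩Y : L τ F ⊆ L τ F ∩ Y
    LF⊆LF∩Y u∈ with x∈L⁻ τ u∈
    ... | i , i∈F , u∈τi = x∈p∩q⁺ (u∈ , all⊆ i i∈F u∈τi)
  ... | no ¬all⊆ with ¬∀⟶∃¬ k _ (λ i → (i ∈? F) →-dec (τ i ⊆? Y)) ¬all⊆
  ...   | i , ¬[i∈F→τi⊆Y] with i ∈? F
  ...     | yes i∈F = i , i∈F , live i i∈F , λ τi⊆Y → ¬[i∈F→τi⊆Y] (λ _ → τi⊆Y)
  ...     | no i∉F = ⊥-elim (¬[i∈F→τi⊆Y] (λ i∈F → ⊥-elim (i∉F i∈F)))

  -- Submodularity of F ↦ ∣ L τ F ∩ Y ∣, with ThinIn bounding the intersection term.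
  Tight-∪ : ∀ {Y x} A B → ThinIn Y → Tight Y A → Tight Y B → x ∈ L τ A ∩ Y → x ∈ L τ B ∩ Y → Tight Y (A ∪ B)
  Tight-∪ {Y} {x} A B thinY (neA , liveA , tightA) (neB , liveB , tightB) x∈LA x∈LB =
    (proj₁ neA , x∈p∪q⁺ (inj₁ (proj₂ neA))) , live , +-cancelˡ-≤ (suc ∣ A ∩ B ∣) _ _ (begin
      suc ∣ A ∩ B ∣ + ∣ L τ (A ∪ B) ∩ Y ∣ ≤⟨ +-mono-≤ ∣A∩B∣<∣LA∩LB∣ (p⊆q⇒∣p∣≤∣q∣ L[A∪B]∩Y⊆LA∪LB) ⟩
      ∣ LA ∩ LB ∣ + ∣ LA ∪ LB ∣ ≡⟨ +-comm ∣ LA ∩ LB ∣ _ ⟩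
      ∣ LA ∪ LB ∣ + ∣ LA ∩ LB ∣ ≡⟨ ∣p∪q∣+∣p∩q∣≡∣p∣+∣q∣ LA LB ⟩
      ∣ LA ∣ + ∣ LB ∣ ≤⟨ +-mono-≤ tightA tightB ⟩
      suc ∣ A ∣ + suc ∣ B ∣ ≡⟨ cong suc (+-suc ∣ A ∣ ∣ B ∣) ⟩
      suc (suc (∣ A ∣ + ∣ B ∣)) ≡⟨ cong (λ t → suc (suc t)) (∣p∪q∣+∣p∩q∣≡∣p∣+∣q∣ A B) ⟨
      suc (suc (∣ A ∪ B ∣ + ∣ A ∩ B ∣)) ≡⟨ cong suc (+-comm (suc ∣ A ∪ B ∣) ∣ A ∩ B ∣) ⟩
      suc ∣ A ∩ B ∣ + suc ∣ A ∪ B ∣ ∎)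
    where
    open ≤-Reasoning
    LA = L τ A ∩ Y
    LB = L τ B ∩ Y
    live : AllLive Y (A ∪ B)
    live i i∈ = [ liveA i , liveB i ]′ (x∈p∪q⁻ A B i∈)
    L[A∪B]∩Y⊆LA∪LB : L τ (A ∪ B) ∩ Y ⊆ LA ∪ LB
    L[A∪B]∩Y⊆LA∪LB u∈ with x∈p∩q⁻ _ Y u∈
    ... | u∈L , u∈Y with x∈L⁻ τ u∈L
    ...   | i , i∈A∪B , u∈τi with x∈p∪q⁻ A B i∈A∪B
    ...     | inj₁ i∈A = x∈p∪q⁺ (inj₁ (x∈p∩q⁺ (x∈L⁺ τ i∈A u∈τi , u∈Y)))
    ...     | inj₂ i∈B = x∈p∪q⁺ (inj₂ (x∈p∩q⁺ (x∈L⁺ τ i∈B u∈τi , u∈Y)))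
    ∣A∩B∣<∣LA∩LB∣ : suc ∣ A ∩ B ∣ ≤ ∣ LA ∩ LB ∣
    ∣A∩B∣<∣LA∩LB∣ with nonempty? (A ∩ B)
    ... | yes ne = ≤-trans (thinY (A ∩ B) ne (λ i i∈ → liveA i (proj₁ (x∈p∩q⁻ A B i∈))))
                     (p⊆q⇒∣p∣≤∣q∣ (λ u∈ → x∈p∩q⁺ (L∩-mono τ (p∩q⊆p A B) u∈ , L∩-mono τ (p∩q⊆q A B) u∈)))
    ... | no empty = subst (λ t → suc t ≤ ∣ LA ∩ LB ∣) (sym (trans (cong ∣_∣ (Empty-unique empty)) (∣⊥∣≡0 k)))
                       (x∈p⇒1≤∣p∣ (x∈p∩q⁺ (x∈LA , x∈LB)))

  MiddleNext⇒Straddles : ∀ {Y x i} → x ∈ Y → MiddleNext Y x i → Straddles Y i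
  MiddleNext⇒Straddles {Y} {x} {i} x∈Y (x∈τi , (a , a∈τi , a∉Y) , (c , c∈τi , c∈Y , c≢x)) =
    ∈∧∈∧≢⇒2≤∣p∣ (x∈p∩q⁺ (x∈τi , x∈Y)) (x∈p∩q⁺ (c∈τi , c∈Y)) (λ x≡c → c≢x (sym x≡c)) ,
    λ τi⊆Y → a∉Y (τi⊆Y a∈τi)

  Live-remove : ∀ {Y x i} → Live (Y - x) i → Live Y i
  Live-remove {Y} {x} {i} live = ≤-trans live (p⊆q⇒∣p∣≤∣q∣ τi∩[Y-x]⊆τi∩Y)
    where
    τi∩[Y-x]⊆τi∩Y : τ i ∩ (Y - x) ⊆ τ i ∩ Y
    τi∩[Y-x]⊆τi∩Y u∈ with x∈p∩q⁻ (τ i) (Y - x) u∈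
    ... | u∈τi , u∈Y-x = x∈p∩q⁺ (u∈τi , proj₁ (x∈p-y⁻ u∈Y-x))

  -- Removing x costs at most one element of L τ F ∩ Y, and none if x ∉ L τ F.
  ThinIn-remove : ∀ {Y} x → ThinIn Y → ∀ F → Nonempty F → AllLive Y F →
                  ¬ ∣ L τ F ∩ Y ∣ ≤ suc ∣ F ∣ ⊎ x ∉ L τ F → suc ∣ F ∣ ≤ ∣ L τ F ∩ (Y - x) ∣
  ThinIn-remove {Y} x thinY F ne live (inj₁ ¬tight) =
    ≤-pred (≤-trans (≰⇒> ¬tight) (p⊆q∪⁅x⁆⇒∣p∣≤1+∣q∣ LF∩Y⊆))
    where
    LF∩Y⊆ : L τ F ∩ Y ⊆ (L τ F ∩ (Y - x)) ∪ ⁅ x ⁆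
    LF∩Y⊆ {u} u∈ with x∈p∩q⁻ _ _ u∈ | u ≟F x
    ... | _ | yes refl = x∈p∪q⁺ (inj₂ (x∈⁅x⁆ u))
    ... | u∈L , u∈Y | no u≢x = x∈p∪q⁺ (inj₁ (x∈p∩q⁺ (u∈L , x∈p∧x≢y⇒x∈p-y u∈Y u≢x)))
  ThinIn-remove {Y} x thinY F ne live (inj₂ x∉LF) = ≤-trans (thinY F ne live) (p⊆q⇒∣p∣≤∣q∣ LF∩Y⊆)
    where
    LF∩Y⊆ : L τ F ∩ Y ⊆ L τ F ∩ (Y - x)
    LF∩Y⊆ u∈ with x∈p∩q⁻ _ _ u∈
    ... | u∈L , u∈Y = x∈p∩q⁺ (u∈L , x∈p∧x≢y⇒x∈p-y u∈Y (λ u≡x → x∉LF (subst (_∈ L τ F) u≡x u∈L)))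

  no-straddle⇒Eligible : ∀ {Y x} → ThinIn Y → (∀ i → ¬ Straddles Y i) → x ∈ Y → Eligible Y x
  no-straddle⇒Eligible {Y} {x} thinY ∄straddle x∈Y =
    x∈Y , (λ i _ mid _ → ⊥-elim (∄straddle i (MiddleNext⇒Straddles x∈Y mid))) , thin[Y-x]
    where
    thin[Y-x] : ThinIn (Y - x)
    thin[Y-x] F ne live′ = ThinIn-remove x thinY F ne live (inj₁ λ tight →
      let (i , _ , straddles) = Tight⇒∃Straddles (ne , live , tight) in ∄straddle i straddles)
      where
      live : AllLive Y F
      live i i∈F = Live-remove (live′ i i∈F)

  -- If x is unobstructed for the triple q it straddles, then x is the middle only
  -- of q, q dies once x is placed, and every family containing x stays non-tight.
  unobstructed⇒Eligible : ∀ {Y q x w} → ThinIn Y → Straddles Y q → StraddlesAt Y q x w →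
                          ¬ Obstructed Y x q → Eligible Y x
  unobstructed⇒Eligible {Y} {q} {x} {w} thinY straddles (x∈ , w∈ , x≢w , only) unobstructed =
    x∈Y , (λ i j mi mj → trans (middle⇒q i mi) (sym (middle⇒q j mj))) , thin[Y-x]
    where
    x∈Y = proj₂ (x∈p∩q⁻ _ _ x∈)
    middle⇒q : ∀ i → MiddleNext Y x i → i ≡ q
    middle⇒q i mid with i ≟F q
    ... | yes i≡q = i≡q
    ... | no i≢q = ⊥-elim (unobstructed (⁅ i ⁆ , Straddles⇒Tight⁅⁆ (MiddleNext⇒Straddles x∈Y mid) ,
                     (λ q∈⁅i⁆ → i≢q (sym (x∈⁅y⁆⇒x≡y i q∈⁅i⁆))) ,
                     x∈p∩q⁺ (x∈L⁺ τ (x∈⁅x⁆ i) (proj₁ mid) , x∈Y)))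
    q-dies : ¬ Live (Y - x) q
    q-dies live = <⇒≱ (s≤s (≤-trans (p⊆q⇒∣p∣≤∣q∣ τq∩[Y-x]⊆⁅w⁆) (≤-reflexive (∣⁅x⁆∣≡1 w)))) live
      where
      τq∩[Y-x]⊆⁅w⁆ : τ q ∩ (Y - x) ⊆ ⁅ w ⁆
      τq∩[Y-x]⊆⁅w⁆ {u} u∈ with x∈p∩q⁻ _ _ u∈
      ... | u∈τq , u∈Y-x with x∈p-y⁻ u∈Y-x
      ...   | u∈Y , u≢x with only u (x∈p∩q⁺ (u∈τq , u∈Y))
      ...     | inj₁ u≡x = ⊥-elim (u≢x u≡x)
      ...     | inj₂ refl = x∈⁅x⁆ u
    thin[Y-x] : ThinIn (Y - x)
    thin[Y-x] F ne live′ = ThinIn-remove x thinY F ne live non-tight-or-x∉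
      where
      live : AllLive Y F
      live i i∈F = Live-remove (live′ i i∈F)
      non-tight-or-x∉ : ¬ ∣ L τ F ∩ Y ∣ ≤ suc ∣ F ∣ ⊎ x ∉ L τ F
      non-tight-or-x∉ with x ∈? L τ F
      ... | no x∉ = inj₂ x∉
      ... | yes x∈L = inj₁ λ tight → unobstructed
            (F , (ne , live , tight) , (λ q∈F → q-dies (live′ q q∈F)) , x∈p∩q⁺ (x∈L , x∈Y))

  ∈τ∩Y⇒∈L∩Y : ∀ {Y F u i} → i ∈ F → u ∈ τ i ∩ Y → u ∈ L τ F ∩ Y
  ∈τ∩Y⇒∈L∩Y i∈F u∈ with x∈p∩q⁻ _ _ u∈
  ... | u∈τi , u∈Y = x∈p∩q⁺ (x∈L⁺ τ i∈F u∈τi , u∈Y)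

  StraddlesAt-swap : ∀ {Y i z w} → StraddlesAt Y i z w → StraddlesAt Y i w z
  StraddlesAt-swap (z∈ , w∈ , z≢w , only) =
    w∈ , z∈ , (λ w≡z → z≢w (sym w≡z)) , λ u u∈ → [ inj₂ , inj₁ ]′ (only u u∈)

  Obstruction-∪ : ∀ {Y x q F H} → ThinIn Y → Obstruction Y x q F → Obstruction Y x q H → Obstruction Y x q (F ∪ H)
  Obstruction-∪ {F = F} {H} thinY (tightF , q∉F , x∈LF) (tightH , q∉H , x∈LH) =
    Tight-∪ F H thinY tightF tightH x∈LF x∈LH ,
    (λ q∈ → [ q∉F , q∉H ]′ (x∈p∪q⁻ F H q∈)) ,
    L∩-mono τ (p⊆p∪q {p = F} H) x∈LF

  maximal-obstruction : ∀ {Y x q} → ThinIn Y → ∀ F → Obstruction Y x q F → ∃ (MaximalObstruction Y x q)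
  maximal-obstruction {Y} {x} {q} thinY F obs = enlarge F obs (<-wellFounded (k ∸ ∣ F ∣))
    where
    enlarge : ∀ F → Obstruction Y x q F → Acc _<_ (k ∸ ∣ F ∣) → ∃ (MaximalObstruction Y x q)
    enlarge F obs (acc rs) with anySubset? (λ H → Obstruction? Y x q H ×-dec ¬? (H ⊆? F))
    ... | no ∄H = F , obs , H⊆F
      where
      H⊆F : ∀ H → Obstruction Y x q H → H ⊆ F
      H⊆F H obsH with H ⊆? F
      ... | yes H⊆F = H⊆F
      ... | no H⊈F = ⊥-elim (∄H (H , obsH , H⊈F))
    ... | yes (H , obsH , H⊈F) with p⊈q⇒∃ H⊈F
    ...   | y , y∈H , y∉F = enlarge (F ∪ H) (Obstruction-∪ thinY obs obsH)
            (rs (∸-monoʳ-< (p⊂q⇒∣p∣<∣q∣ (p⊆p∪q H , y , x∈p∪q⁺ (inj₂ y∈H) , y∉F)) (∣p∣≤n (F ∪ H))))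

  MaximalObstruction-⊃ : ∀ {Y x q F z r H} → ThinIn Y → MaximalObstruction Y x q F → r ∈ F → z ∈ τ r ∩ Y →
                          Obstruction Y z r H → q ∉ H → H ⊂ F
  MaximalObstruction-⊃ {F = F} {H = H} thinY ((tightF , q∉F , x∈LF) , maxF) r∈F z∈ (tightH , r∉H , z∈LH) q∉H =
    H⊆F , _ , r∈F , r∉H
    where
    H⊆F : H ⊆ F
    H⊆F h∈H = maxF (H ∪ F)
      (Tight-∪ H F thinY tightH tightF z∈LH (∈τ∩Y⇒∈L∩Y r∈F z∈) ,
       (λ q∈ → [ q∉H , q∉F ]′ (x∈p∪q⁻ H F q∈)) ,
       L∩-mono τ (q⊆p∪q H F) x∈LF)
      (x∈p∪q⁺ (inj₁ h∈H))

  -- H ∪ H′ ∪ ⁅ r ⁆ would violate ThinIn: adding r adds no new element of Y to L.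
  overlapping-obstructions-absurd : ∀ {Y r z w x H H′} → ThinIn Y → Straddles Y r → StraddlesAt Y r z w →
      Obstruction Y z r H → Obstruction Y w r H′ → x ∈ L τ H ∩ Y → x ∈ L τ H′ ∩ Y → ⊥
  overlapping-obstructions-absurd {Y} {r} {H = H} {H′} thinY (live-r , _) (_ , _ , _ , only)
    (tightH , r∉H , z∈LH) (tightH′ , r∉H′ , w∈LH′) x∈LH x∈LH′ = <⇒≱ (s≤s ∣LU∩Y∣≤1+∣U∣) (begin
      suc (suc ∣ U ∣) ≡⟨ cong suc (x∉p⇒∣p∪⁅x⁆∣≡1+∣p∣ U r∉U) ⟨
      suc ∣ U ∪ ⁅ r ⁆ ∣ ≤⟨ thinY (U ∪ ⁅ r ⁆) (r , x∈p∪q⁺ (inj₂ (x∈⁅x⁆ r))) live ⟩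
      ∣ L τ (U ∪ ⁅ r ⁆) ∩ Y ∣ ≤⟨ p⊆q⇒∣p∣≤∣q∣ L[U∪⁅r⁆]∩Y⊆LU∩Y ⟩
      ∣ L τ U ∩ Y ∣ ∎)
    where
    open ≤-Reasoning
    U = H ∪ H′
    tightU : Tight Y U
    tightU = Tight-∪ H H′ thinY tightH tightH′ x∈LH x∈LH′
    ∣LU∩Y∣≤1+∣U∣ = proj₂ (proj₂ tightU)
    r∉U : r ∉ U
    r∉U r∈ = [ r∉H , r∉H′ ]′ (x∈p∪q⁻ H H′ r∈)
    live : AllLive Y (U ∪ ⁅ r ⁆)
    live i i∈ with x∈p∪q⁻ U ⁅ r ⁆ i∈
    ... | inj₁ i∈U = proj₁ (proj₂ tightU) i i∈U
    ... | inj₂ i∈⁅r⁆ = subst (Live Y) (sym (x∈⁅y⁆⇒x≡y r i∈⁅r⁆)) live-r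
    L[U∪⁅r⁆]∩Y⊆LU∩Y : L τ (U ∪ ⁅ r ⁆) ∩ Y ⊆ L τ U ∩ Y
    L[U∪⁅r⁆]∩Y⊆LU∩Y {u} u∈ with x∈p∩q⁻ _ _ u∈
    ... | u∈L , u∈Y with x∈L⁻ τ u∈L
    ...   | i , i∈ , u∈τi with x∈p∪q⁻ U ⁅ r ⁆ i∈
    ...     | inj₁ i∈U = x∈p∩q⁺ (x∈L⁺ τ i∈U u∈τi , u∈Y)
    ...     | inj₂ i∈⁅r⁆ with only u (x∈p∩q⁺ (subst (λ t → u ∈ τ t) (x∈⁅y⁆⇒x≡y r i∈⁅r⁆) u∈τi , u∈Y))
    ...       | inj₁ refl = L∩-mono τ (p⊆p∪q {p = H} H′) z∈LH
    ...       | inj₂ refl = L∩-mono τ (q⊆p∪q H H′) w∈LH′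

  -- If both elements of a triple r ∈ F straddling Y are obstructed for r, the
  -- maximal obstruction of one of them avoids q and so lies strictly inside F.
  Eligible-from-obstruction : ∀ {Y x q} → ThinIn Y → ∀ F → Acc _<_ ∣ F ∣ → Straddles Y q → x ∈ τ q ∩ Y →
                              MaximalObstruction Y x q F → ∃ (Eligible Y)
  Eligible-from-obstruction {Y} {x} {q} thinY F (acc rs) straddles-q x∈ maxF@((tightF , _) , _)
    with Tight⇒∃Straddles tightF
  ... | r , r∈F , straddles-r with Straddles⇒∃StraddlesAt straddles-r
  ... | z , w , at@(z∈ , w∈ , _) with Obstructed? Y z r | Obstructed? Y w r
  ... | no ¬obs | _ = z , unobstructed⇒Eligible thinY straddles-r at ¬obs
  ... | yes _ | no ¬obs = w , unobstructed⇒Eligible thinY straddles-r (StraddlesAt-swap at) ¬obs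
  ... | yes (H₀ , obsH₀) | yes (H₀′ , obsH₀′)
    with maximal-obstruction thinY H₀ obsH₀ | maximal-obstruction thinY H₀′ obsH₀′
  ... | H , maxH@(obsH , _) | H′ , maxH′@(obsH′ , _) with q ∈? H | q ∈? H′
  ... | no q∉H | _ = Eligible-from-obstruction thinY H
        (rs (p⊂q⇒∣p∣<∣q∣ (MaximalObstruction-⊃ thinY maxF r∈F z∈ obsH q∉H))) straddles-r z∈ maxH
  ... | yes _ | no q∉H′ = Eligible-from-obstruction thinY H′
        (rs (p⊂q⇒∣p∣<∣q∣ (MaximalObstruction-⊃ thinY maxF r∈F w∈ obsH′ q∉H′))) straddles-r w∈ maxH′
  ... | yes q∈H | yes q∈H′ = ⊥-elim (overlapping-obstructions-absurd thinY straddles-r at obsH obsH′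
        (∈τ∩Y⇒∈L∩Y q∈H x∈) (∈τ∩Y⇒∈L∩Y q∈H′ x∈))

  Eligible-exists : ∀ {Y} → ThinIn Y → Nonempty Y → ∃ (Eligible Y)
  Eligible-exists {Y} thinY (y , y∈Y) with any? (Straddles? Y)
  ... | no ∄straddle = y , no-straddle⇒Eligible thinY (λ i s → ∄straddle (i , s)) y∈Y
  ... | yes (q , straddles) with Straddles⇒∃StraddlesAt straddles
  ...   | x , w , at with Obstructed? Y x q
  ...     | no ¬obs = x , unobstructed⇒Eligible thinY straddles at ¬obs
  ...     | yes (F , obs) with maximal-obstruction thinY F obs
  ...       | G , maxG = Eligible-from-obstruction thinY G (<-wellFounded ∣ G ∣) straddles (proj₁ at) maxG

  -- An arrangement of Y lists it after the already placed elements X ∖ Y.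
  MiddleIn : Subset n → List (Fin n) → Subset n → Fin n → Set
  MiddleIn Y l s b = b ∈ s × (∃ λ a → a ∈ s × (a ∉ Y ⊎ Precedes l a b)) × (∃ λ c → c ∈ s × Precedes l b c)

  MiddleIn-tail : ∀ {Y x l s b} → b ≢ x → MiddleIn Y (x ∷ l) s b → MiddleIn (Y - x) l s b
  MiddleIn-tail {Y} {x} {l} {s} {b} b≢x (b∈s , (a , a∈s , a∉Y⊎a≺b) , (c , c∈s , b≺c)) =
    b∈s , (a , a∈s , earlier a∉Y⊎a≺b) , (c , c∈s , later b≺c)
    where
    earlier : a ∉ Y ⊎ Precedes (x ∷ l) a b → a ∉ Y - x ⊎ Precedes l a b
    earlier (inj₁ a∉Y) = inj₁ (λ a∈ → a∉Y (proj₁ (x∈p-y⁻ a∈)))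
    earlier (inj₂ (inj₁ (refl , _))) = inj₁ (λ a∈ → proj₂ (x∈p-y⁻ a∈) refl)
    earlier (inj₂ (inj₂ a≺b)) = inj₂ a≺b
    later : Precedes (x ∷ l) b c → Precedes l b c
    later (inj₁ (b≡x , _)) = ⊥-elim (b≢x b≡x)
    later (inj₂ b≺c) = b≺c

  MiddleIn-head⇒MiddleNext : ∀ {Y x l i} → (∀ {y} → y ∈ₗ l → y ∈ Y - x) →
                             MiddleIn Y (x ∷ l) (τ i) x → MiddleNext Y x i
  MiddleIn-head⇒MiddleNext {Y} {x} {l} l⊆Y-x (x∈τi , (a , a∈τi , a∉Y⊎a≺x) , (c , c∈τi , x≺c)) =
    x∈τi , (a , a∈τi , placed a∉Y⊎a≺x) , (c , c∈τi , later x≺c)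
    where
    x∉l : ¬ x ∈ₗ l
    x∉l x∈ = proj₂ (x∈p-y⁻ (l⊆Y-x x∈)) refl
    placed : a ∉ Y ⊎ Precedes (x ∷ l) a x → a ∉ Y
    placed (inj₁ a∉Y) = a∉Y
    placed (inj₂ (inj₁ (_ , x∈))) = ⊥-elim (x∉l x∈)
    placed (inj₂ (inj₂ a≺x)) = ⊥-elim (x∉l (Precedes⇒∈ʳ l a≺x))
    later : Precedes (x ∷ l) x c → c ∈ Y × c ≢ x
    later (inj₁ (_ , c∈)) = x∈p-y⁻ (l⊆Y-x c∈)
    later (inj₂ x≺c) = ⊥-elim (x∉l (Precedes⇒∈ˡ l x≺c))

  record Arrangement (Y : Subset n) : Set where
    field
      order : List (Fin n)
      length≡ : length order ≡ ∣ Y ∣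
      unique : Unique order
      complete : ∀ {x} → x ∈ Y → x ∈ₗ order
      sound : ∀ {x} → x ∈ₗ order → x ∈ Y
      middle-injective : ∀ i j b → MiddleIn Y order (τ i) b → MiddleIn Y order (τ j) b → i ≡ j

  Arrangement-∷ : ∀ {Y x} → Eligible Y x → Arrangement (Y - x) → Arrangement Y
  Arrangement-∷ {Y} {x} (x∈Y , middle-unique , _) arr = record
    { order = x ∷ order
    ; length≡ = trans (cong suc length≡) (x∈p⇒1+∣p-x∣≡∣p∣ x∈Y)
    ; unique = All.tabulate (λ y∈ x≡y → proj₂ (x∈p-y⁻ (sound y∈)) (sym x≡y)) ∷ unique
    ; complete = complete′
    ; sound = sound′
    ; middle-injective = middle-injective′
    }
    where
    open Arrangement arr
    complete′ : ∀ {y} → y ∈ Y → y ∈ₗ x ∷ order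
    complete′ {y} y∈Y with y ≟F x
    ... | yes y≡x = here y≡x
    ... | no y≢x = there (complete (x∈p∧x≢y⇒x∈p-y y∈Y y≢x))
    sound′ : ∀ {y} → y ∈ₗ x ∷ order → y ∈ Y
    sound′ (here refl) = x∈Y
    sound′ (there y∈) = proj₁ (x∈p-y⁻ (sound y∈))
    middle-injective′ : ∀ i j b → MiddleIn Y (x ∷ order) (τ i) b → MiddleIn Y (x ∷ order) (τ j) b → i ≡ j
    middle-injective′ i j b mi mj with b ≟F x
    ... | yes refl = middle-unique i j (MiddleIn-head⇒MiddleNext sound mi) (MiddleIn-head⇒MiddleNext sound mj)
    ... | no b≢x = middle-injective i j b (MiddleIn-tail b≢x mi) (MiddleIn-tail b≢x mj)

  arrange : ∀ {r} Y → ∣ Y ∣ ≡ r → ThinIn Y → Arrangement Y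
  arrange {zero} Y ∣Y∣≡0 thinY = record
    { order = []
    ; length≡ = sym ∣Y∣≡0
    ; unique = []
    ; complete = λ x∈Y → ⊥-elim (<⇒≱ (x∈p⇒1≤∣p∣ x∈Y) (≤-reflexive ∣Y∣≡0))
    ; sound = λ ()
    ; middle-injective = λ { _ _ _ (_ , _ , _ , _ , ()) _ }
    }
  arrange {suc r} Y ∣Y∣≡1+r thinY
    with Eligible-exists thinY (1≤∣p∣⇒Nonempty Y (≤-trans (s≤s z≤n) (≤-reflexive (sym ∣Y∣≡1+r))))
  ... | x , eligible@(x∈Y , _ , thin[Y-x]) =
    Arrangement-∷ eligible (arrange (Y - x) (suc-injective (trans (x∈p⇒1+∣p-x∣≡∣p∣ x∈Y) ∣Y∣≡1+r)) thin[Y-x])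

  arrangement : Arrangement ⊤
  arrangement = arrange ⊤ (∣⊤∣≡n n) thin⊤
    where
    thin⊤ : ThinIn ⊤
    thin⊤ F ne _ = begin
      suc ∣ F ∣ ≤⟨ n≤1+n (suc ∣ F ∣) ⟩
      2 + ∣ F ∣ ≡⟨ +-comm 2 ∣ F ∣ ⟩
      ∣ F ∣ + 2 ≤⟨ thin F ne ⟩
      ∣ L τ F ∣ ≤⟨ p⊆q⇒∣p∣≤∣q∣ {p = L τ F} (λ u∈ → x∈p∩q⁺ (u∈ , ∈⊤)) ⟩
      ∣ L τ F ∩ ⊤ ∣ ∎
      where open ≤-Reasoning

-- Positions in a list

module ListPosition {A : Set} (_≟_ : DecidableEquality A) where

  position : A → List A → ℕ
  position x [] = 0
  position x (y ∷ l) with x ≟ y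
  ... | yes _ = 0
  ... | no _ = suc (position x l)

  private
    ∈-tail : ∀ {x y : A} {l} → x ∈ₗ y ∷ l → x ≢ y → x ∈ₗ l
    ∈-tail (here x≡y) x≢y = ⊥-elim (x≢y x≡y)
    ∈-tail (there x∈l) _ = x∈l

  position-< : ∀ {x : A} l → x ∈ₗ l → position x l < length l
  position-< {x} (y ∷ l) x∈ with x ≟ y
  ... | yes _ = s≤s z≤n
  ... | no x≢y = s≤s (position-< l (∈-tail x∈ x≢y))

  position-injective : ∀ {x y : A} l → x ∈ₗ l → y ∈ₗ l → position x l ≡ position y l → x ≡ y
  position-injective {x} {y} (z ∷ l) x∈ y∈ e with x ≟ z | y ≟ z
  ... | yes x≡z | yes y≡z = trans x≡z (sym y≡z)
  ... | yes _ | no _ = ⊥-elim (0≢1+n e)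
  ... | no _ | yes _ = ⊥-elim (0≢1+n (sym e))
  ... | no x≢z | no y≢z = position-injective l (∈-tail x∈ x≢z) (∈-tail y∈ y≢z) (suc-injective e)

  position-here : ∀ {x y : A} l → x ≡ y → position x (y ∷ l) ≡ 0
  position-here {x} {y} l x≡y with x ≟ y
  ... | yes _ = refl
  ... | no x≢y = ⊥-elim (x≢y x≡y)

  position-there : ∀ {x y : A} l → x ≢ y → position x (y ∷ l) ≡ suc (position x l)
  position-there {x} {y} l x≢y with x ≟ y
  ... | yes x≡y = ⊥-elim (x≢y x≡y)
  ... | no _ = refl

  position-surjective : ∀ l → Unique l → ∀ {t} → t < length l → ∃ λ x → x ∈ₗ l × position x l ≡ t
  position-surjective (z ∷ l) _ {zero} _ = z , here refl , position-here l refl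
  position-surjective (z ∷ l) un {suc t} (s≤s t<∣l∣) with position-surjective l (tail un) t<∣l∣
  ... | x , x∈l , e = x , there x∈l ,
        trans (position-there l (λ x≡z → Unique[x∷xs]⇒x∉xs un (subst (_∈ₗ l) x≡z x∈l))) (cong suc e)

  position-<⇒Precedes : ∀ l {x y : A} → x ∈ₗ l → y ∈ₗ l → position x l < position y l → Precedes l x y
  position-<⇒Precedes (z ∷ l) {x} {y} x∈ y∈ x<y with x ≟ z | y ≟ z
  ... | _ | yes _ = ⊥-elim (n≮0 x<y)
  ... | yes x≡z | no y≢z = inj₁ (x≡z , ∈-tail y∈ y≢z)
  ... | no x≢z | no y≢z = inj₂ (position-<⇒Precedes l (∈-tail x∈ x≢z) (∈-tail y∈ y≢z) (≤-pred x<y))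

module _ {A : Set} (rank : A → ℕ) (rank-injective : ∀ {x y} → rank x ≡ rank y → x ≡ y) where

  rank-compare : ∀ x y → x ≢ y → rank x < rank y ⊎ rank y < rank x
  rank-compare x y x≢y with <-cmp (rank x) (rank y)
  ... | tri< x<y _ _ = inj₁ x<y
  ... | tri≈ _ x≡y _ = ⊥-elim (x≢y (rank-injective x≡y))
  ... | tri> _ _ y<x = inj₂ y<x

  sort-distinct : ∀ {P : A → Set} {a b c} → P a → P b → P c → a ≢ b → a ≢ c → b ≢ c →
                  ∃ λ x → ∃ λ y → ∃ λ z → P x × P y × P z × rank x < rank y × rank y < rank z
  sort-distinct {a = a} {b} {c} a∈ b∈ c∈ a≢b a≢c b≢c
    with rank-compare a b a≢b | rank-compare b c b≢c | rank-compare a c a≢c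
  ... | inj₁ a<b | inj₁ b<c | _ = a , b , c , a∈ , b∈ , c∈ , a<b , b<c
  ... | inj₁ a<b | inj₂ c<b | inj₁ a<c = a , c , b , a∈ , c∈ , b∈ , a<c , c<b
  ... | inj₁ a<b | inj₂ c<b | inj₂ c<a = c , a , b , c∈ , a∈ , b∈ , c<a , a<b
  ... | inj₂ b<a | inj₁ b<c | inj₁ a<c = b , a , c , b∈ , a∈ , c∈ , b<a , a<c
  ... | inj₂ b<a | inj₁ b<c | inj₂ c<a = b , c , a , b∈ , c∈ , a∈ , b<c , c<a
  ... | inj₂ b<a | inj₂ c<b | _ = c , b , a , c∈ , b∈ , a∈ , c<b , b<a

-- Graphs layered by a height function

module Layering {m : ℕ} (adj : Fin m → Subset m) where
  open GraphNotions adj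

  Walk⇒start∈ : ∀ {u v vs} → Walk u v vs → u ∈ₗ vs
  Walk⇒start∈ (here v) = here refl
  Walk⇒start∈ (step _ _) = here refl

  Walk⇒end∈ : ∀ {u v vs} → Walk u v vs → v ∈ₗ vs
  Walk⇒end∈ (here v) = here refl
  Walk⇒end∈ (step _ W) = there (Walk⇒end∈ W)

  Walk-++ : ∀ {a b c xs ys} → Walk a b xs → Walk b c ys → ∃ λ zs → Walk a c zs
  Walk-++ (here _) W = _ , W
  Walk-++ (step a∼ W₁) W = _ , step a∼ (proj₂ (Walk-++ W₁ W))

  Walk-reverse : (∀ u v → Adj u v → Adj v u) → ∀ {a b vs} → Walk a b vs → ∃ λ ws → Walk b a ws
  Walk-reverse Adj-sym (here a) = _ , here a
  Walk-reverse Adj-sym (step {a} {w} a∼w W) = Walk-++ (proj₂ (Walk-reverse Adj-sym W)) (step (Adj-sym a w a∼w) (here a))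

  -- Heights change by one along each edge and every vertex has at most one
  -- lower neighbour. Then a path never turns from ascending to descending,
  -- since the turning vertex would have two lower neighbours: paths are valleys.
  module Layered (Adj-sym : ∀ u v → Adj u v → Adj v u) (h : Fin m → ℕ)
                 (h-step : ∀ u v → Adj u v → h v ≡ suc (h u) ⊎ h u ≡ suc (h v))
                 (lower-unique : ∀ u a b → Adj u a → Adj u b → h a < h u → h b < h u → a ≡ b) where

    DownClosed : (Fin m → Set) → Set
    DownClosed Q = ∀ u w → Adj u w → h w < h u → Q u → Q w

    ascent-continues : ∀ {p w w′} → Adj p w → h p < h w → Adj w w′ → h w ≡ suc (h w′) → p ≡ w′
    ascent-continues p∼w p<w w∼w′ w≡1+w′ = lower-unique _ _ _ (Adj-sym _ _ p∼w) w∼w′ p<w (≤-reflexive (sym w≡1+w′))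

    -- A path entered from below by the step p ∼ w (p not on it) only ascends.
    ascent-DownClosed : ∀ {Q} → DownClosed Q → ∀ {p w b ws} → Adj p w → h p < h w → Walk w b ws → Unique ws →
                        ¬ p ∈ₗ ws → Q b → ∀ y → y ∈ₗ ws → Q y
    ascent-DownClosed Q↓ p∼w p<w (here _) _ _ Qb y (here refl) = Qb
    ascent-DownClosed Q↓ p∼w p<w (step {w} {w′} w∼w′ W) un p∉ Qb y y∈ with h-step w w′ w∼w′
    ... | inj₂ w≡1+w′ = ⊥-elim (p∉ (subst (_∈ₗ _) (sym (ascent-continues p∼w p<w w∼w′ w≡1+w′)) (there (Walk⇒start∈ W))))
    ... | inj₁ w′≡1+w with y∈
    ...   | there y∈′ = ascent-DownClosed Q↓ w∼w′ (≤-reflexive (sym w′≡1+w)) W (tail un) (Unique[x∷xs]⇒x∉xs un) Qb y y∈′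
    ...   | here refl = Q↓ w′ y (Adj-sym y w′ w∼w′) (≤-reflexive (sym w′≡1+w))
                          (ascent-DownClosed Q↓ w∼w′ (≤-reflexive (sym w′≡1+w)) W (tail un) (Unique[x∷xs]⇒x∉xs un) Qb w′ (Walk⇒start∈ W))

    Path-DownClosed : ∀ {Q} → DownClosed Q → ∀ {a b vs} → Walk a b vs → Unique vs → Q a → Q b → ∀ y → y ∈ₗ vs → Q y
    Path-DownClosed Q↓ (here _) _ Qa _ y (here refl) = Qa
    Path-DownClosed Q↓ (step _ _) _ Qa _ y (here refl) = Qa
    Path-DownClosed Q↓ (step {a} {w} a∼w W) un Qa Qb y (there y∈) with h-step a w a∼w
    ... | inj₁ w≡1+a = ascent-DownClosed Q↓ a∼w (≤-reflexive (sym w≡1+a)) W (tail un) (Unique[x∷xs]⇒x∉xs un) Qb y y∈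
    ... | inj₂ a≡1+w = Path-DownClosed Q↓ W (tail un) (Q↓ a w a∼w (≤-reflexive (sym a≡1+w)) Qa) Qb y y∈

    ascent-top : ∀ {p w b ws} → Adj p w → h p < h w → Walk w b ws → Unique ws → ¬ p ∈ₗ ws →
                 h p < h b × ∃ λ b′ → Adj b b′ × h b′ < h b × ((ws ≡ b ∷ [] × b′ ≡ p) ⊎ b′ ∈ₗ ws)
    ascent-top {p} p∼w p<w (here _) _ _ = p<w , p , Adj-sym p _ p∼w , p<w , inj₁ (refl , refl)
    ascent-top {p} p∼w p<w (step {w} {w′} w∼w′ W) un p∉ with h-step w w′ w∼w′
    ... | inj₂ w≡1+w′ = ⊥-elim (p∉ (subst (_∈ₗ _) (sym (ascent-continues p∼w p<w w∼w′ w≡1+w′)) (there (Walk⇒start∈ W))))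
    ... | inj₁ w′≡1+w with ascent-top w∼w′ (≤-reflexive (sym w′≡1+w)) W (tail un) (Unique[x∷xs]⇒x∉xs un)
    ...   | w<b , b′ , b∼b′ , b′<b , inj₁ (refl , refl) = <-trans p<w w<b , b′ , b∼b′ , b′<b , inj₂ (here refl)
    ...   | w<b , b′ , b∼b′ , b′<b , inj₂ b′∈ = <-trans p<w w<b , b′ , b∼b′ , b′<b , inj₂ (there b′∈)

    lower-neighbour-on-path : ∀ {a b ws} → Walk a b ws → Unique ws → h a < h b → ∃ λ b′ → Adj b b′ × h b′ < h b × b′ ∈ₗ ws
    lower-neighbour-on-path (here _) _ a<a = ⊥-elim (<-irrefl refl a<a)
    lower-neighbour-on-path (step {a} {w} a∼w W) un a<b with h-step a w a∼w
    ... | inj₁ w≡1+a with ascent-top a∼w (≤-reflexive (sym w≡1+a)) W (tail un) (Unique[x∷xs]⇒x∉xs un)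
    ...   | _ , b′ , b∼b′ , b′<b , inj₁ (_ , refl) = b′ , b∼b′ , b′<b , here refl
    ...   | _ , b′ , b∼b′ , b′<b , inj₂ b′∈ = b′ , b∼b′ , b′<b , there b′∈
    lower-neighbour-on-path (step {a} {w} a∼w W) un a<b | inj₂ a≡1+w
      with lower-neighbour-on-path W (tail un) (<-trans (≤-reflexive (sym a≡1+w)) a<b)
    ... | b′ , b∼b′ , b′<b , b′∈ = b′ , b∼b′ , b′<b , there b′∈

    lower-neighbour∉ : ∀ {u v v′ ws} → Adj v u → h v ≡ suc (h u) → Unique (u ∷ ws) → Adj v v′ → h v′ < h v → ¬ v′ ∈ₗ ws
    lower-neighbour∉ {u} {v} {v′} {ws} v∼u v≡1+u un v∼v′ v′<v v′∈ = Unique[x∷xs]⇒x∉xs un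
      (subst (_∈ₗ ws) (lower-unique v v′ u v∼v′ v∼u v′<v (≤-reflexive (sym v≡1+u))) v′∈)

    acyclic : ¬ HasCycle
    acyclic (u , .u , .(u ∷ []) , (here _ , _) , s≤s () , _)
    acyclic (u , v , .(u ∷ ws) , (step {_} {w} {vs = ws} u∼w W , un) , s≤s 2≤∣ws∣ , v∼u)
      with h-step v u v∼u | h-step u w u∼w
    ... | inj₁ u≡1+v | inj₂ u≡1+w = closed-path-absurd (subst (λ t → Walk t v ws) w≡v W) (tail un) 2≤∣ws∣
      where
      w≡v : w ≡ v
      w≡v = lower-unique u w v u∼w (Adj-sym v u v∼u) (≤-reflexive (sym u≡1+w)) (≤-reflexive (sym u≡1+v))
      closed-path-absurd : ∀ {x xs} → Walk x x xs → Unique xs → 2 ≤ length xs → ⊥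
      closed-path-absurd (here _) _ (s≤s ())
      closed-path-absurd (step _ W′) un′ _ = Unique[x∷xs]⇒x∉xs un′ (Walk⇒end∈ W′)
    ... | inj₁ u≡1+v | inj₁ w≡1+u =
      <-asym (proj₁ (ascent-top u∼w (≤-reflexive (sym w≡1+u)) W (tail un) (Unique[x∷xs]⇒x∉xs un))) (≤-reflexive (sym u≡1+v))
    ... | inj₂ v≡1+u | inj₁ w≡1+u with ascent-top u∼w (≤-reflexive (sym w≡1+u)) W (tail un) (Unique[x∷xs]⇒x∉xs un)
    ...   | _ , _ , _ , _ , inj₁ (refl , _) = n≮n 1 2≤∣ws∣
    ...   | _ , v′ , v∼v′ , v′<v , inj₂ v′∈ = lower-neighbour∉ v∼u v≡1+u un v∼v′ v′<v v′∈
    acyclic (u , v , .(u ∷ ws) , (step {_} {w} {vs = ws} u∼w W , un) , _ , v∼u) | inj₂ v≡1+u | inj₂ u≡1+w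
      with lower-neighbour-on-path W (tail un) (<-trans (≤-reflexive (sym u≡1+w)) (≤-reflexive (sym v≡1+u)))
    ... | v′ , v∼v′ , v′<v , v′∈ = lower-neighbour∉ v∼u v≡1+u un v∼v′ v′<v v′∈

-- The caterpillar

-- Vertex t < n is the leaf at position t and vertex n + j (j ≤ S) is the j-th spine vertex;
-- leaf t hangs from spine vertex attach t, so leaves 0, 1 and S + 1, S + 2 form the two cherries.
module CaterpillarShape (d : ℕ) where

  S n m : ℕ
  S = suc d
  n = suc (suc (suc S))
  m = n + suc S

  attach : ℕ → ℕ
  attach zero = zero
  attach (suc t) = t ⊓ S

  attach≤S : ∀ t → attach t ≤ S
  attach≤S zero = z≤n
  attach≤S (suc t) = m⊓n≤n t S

  attach-mono : ∀ {t t′} → t ≤ t′ → attach t ≤ attach t′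
  attach-mono {zero} _ = z≤n
  attach-mono {suc t} {suc t′} (s≤s t≤t′) = ⊓-monoˡ-≤ S t≤t′

  attach-suc : ∀ {t} → t ≤ S → attach (suc t) ≡ t
  attach-suc = m≤n⇒m⊓n≡m

  attach≡0⇒ : ∀ t → attach t ≡ 0 → t ≡ 0 ⊎ t ≡ 1
  attach≡0⇒ zero _ = inj₁ refl
  attach≡0⇒ (suc t) e with ≤-total t S
  ... | inj₁ t≤S = inj₂ (cong suc (trans (sym (m≤n⇒m⊓n≡m t≤S)) e))
  ... | inj₂ S≤t = ⊥-elim (0≢1+n (trans (sym e) (m≥n⇒m⊓n≡n S≤t)))

  attach≡inner⇒ : ∀ t {j} → 0 < j → j < S → attach t ≡ j → t ≡ suc j
  attach≡inner⇒ zero 0<j _ refl = ⊥-elim (<-irrefl refl 0<j)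
  attach≡inner⇒ (suc t) _ j<S e with ≤-total t S
  ... | inj₁ t≤S = cong suc (trans (sym (m≤n⇒m⊓n≡m t≤S)) e)
  ... | inj₂ S≤t = ⊥-elim (<-irrefl (trans (sym e) (m≥n⇒m⊓n≡n S≤t)) j<S)

  attach≡S⇒ : ∀ t → t < n → attach t ≡ S → t ≡ suc S ⊎ t ≡ suc (suc S)
  attach≡S⇒ zero _ ()
  attach≡S⇒ (suc t) (s≤s t<n-1) e with ≤-total t S
  ... | inj₁ t≤S = inj₁ (cong suc (trans (sym (m≤n⇒m⊓n≡m t≤S)) e))
  ... | inj₂ S≤t with m≤n⇒m<n∨m≡n S≤t | m≤n⇒m<n∨m≡n (≤-pred t<n-1)
  ...   | inj₂ refl | _ = inj₁ refl
  ...   | inj₁ _ | inj₂ refl = inj₂ refl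
  ...   | inj₁ S<t | inj₁ t<S+1 = ⊥-elim (<⇒≱ S<t (≤-pred t<S+1))

  -- Only the leaves of a cherry share their spine vertex.
  attach-collision : ∀ t t′ → t ≢ t′ → attach t ≡ attach t′ → attach t ≡ 0 ⊎ attach t ≡ S
  attach-collision t t′ t≢t′ e with attach t ≟ℕ 0 | attach t ≟ℕ S
  ... | yes a≡0 | _ = inj₁ a≡0
  ... | no _ | yes a≡S = inj₂ a≡S
  ... | no a≢0 | no a≢S = ⊥-elim (t≢t′ (trans (attach≡inner⇒ t 0<a a<S refl) (sym (attach≡inner⇒ t′ 0<a a<S (sym e)))))
    where
    0<a = n≢0⇒n>0 a≢0
    a<S = ≤∧≢⇒< (attach≤S t) a≢S

  LeafEdge SpineEdge Edge : ℕ → ℕ → Set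
  LeafEdge t v = t < n × v ≡ n + attach t
  SpineEdge u v = n ≤ u × suc u ≡ v
  Edge u v = LeafEdge u v ⊎ LeafEdge v u ⊎ SpineEdge u v ⊎ SpineEdge v u

  Edge? : ∀ u v → Dec (Edge u v)
  Edge? u v = ((u <? n) ×-dec (v ≟ℕ n + attach u)) ⊎-dec ((v <? n) ×-dec (u ≟ℕ n + attach v)) ⊎-dec
              ((n ≤? u) ×-dec (suc u ≟ℕ v)) ⊎-dec ((n ≤? v) ×-dec (suc v ≟ℕ u))

  Edge-sym : ∀ {u v} → Edge u v → Edge v u
  Edge-sym (inj₁ e) = inj₂ (inj₁ e)
  Edge-sym (inj₂ (inj₁ e)) = inj₁ e
  Edge-sym (inj₂ (inj₂ (inj₁ e))) = inj₂ (inj₂ (inj₂ e))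
  Edge-sym (inj₂ (inj₂ (inj₂ e))) = inj₂ (inj₂ (inj₁ e))

  Edge-irrefl : ∀ u → ¬ Edge u u
  Edge-irrefl u (inj₁ (u<n , e)) = <⇒≱ u<n (≤-trans (m≤m+n n _) (≤-reflexive (sym e)))
  Edge-irrefl u (inj₂ (inj₁ (u<n , e))) = <⇒≱ u<n (≤-trans (m≤m+n n _) (≤-reflexive (sym e)))
  Edge-irrefl u (inj₂ (inj₂ (inj₁ (_ , e)))) = <-irrefl (sym e) (n<1+n u)
  Edge-irrefl u (inj₂ (inj₂ (inj₂ (_ , e)))) = <-irrefl (sym e) (n<1+n u)

  Edge-from-leaf : ∀ {t v} → t < n → Edge t v → v ≡ n + attach t
  Edge-from-leaf _ (inj₁ (_ , e)) = e
  Edge-from-leaf t<n (inj₂ (inj₁ (_ , e))) = ⊥-elim (<⇒≱ t<n (≤-trans (m≤m+n n _) (≤-reflexive (sym e))))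
  Edge-from-leaf t<n (inj₂ (inj₂ (inj₁ (n≤t , _)))) = ⊥-elim (<⇒≱ t<n n≤t)
  Edge-from-leaf {v = v} t<n (inj₂ (inj₂ (inj₂ (n≤v , e)))) = ⊥-elim (<⇒≱ t<n (≤-trans n≤v (≤-trans (n≤1+n v) (≤-reflexive e))))

  Edge-from-spine : ∀ {u v} → n ≤ u → Edge u v → LeafEdge v u ⊎ suc u ≡ v ⊎ SpineEdge v u
  Edge-from-spine n≤u (inj₁ (u<n , _)) = ⊥-elim (<⇒≱ u<n n≤u)
  Edge-from-spine _ (inj₂ (inj₁ e)) = inj₁ e
  Edge-from-spine _ (inj₂ (inj₂ (inj₁ (_ , e)))) = inj₂ (inj₁ e)
  Edge-from-spine _ (inj₂ (inj₂ (inj₂ e))) = inj₂ (inj₂ e)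

  -- Distances to the spine vertices n + 0 and n + S.
  height₀ heightₛ : ℕ → ℕ
  height₀ u with u <? n
  ... | yes _ = suc (attach u)
  ... | no _ = u ∸ n
  heightₛ u with u <? n
  ... | yes _ = suc (S ∸ attach u)
  ... | no _ = S ∸ (u ∸ n)

  height₀-leaf : ∀ {u} → u < n → height₀ u ≡ suc (attach u)
  height₀-leaf {u} u<n with u <? n
  ... | yes _ = refl
  ... | no u≮n = ⊥-elim (u≮n u<n)

  height₀-spine : ∀ {u} → n ≤ u → height₀ u ≡ u ∸ n
  height₀-spine {u} n≤u with u <? n
  ... | yes u<n = ⊥-elim (<⇒≱ u<n n≤u)
  ... | no _ = refl

  heightₛ-leaf : ∀ {u} → u < n → heightₛ u ≡ suc (S ∸ attach u)
  heightₛ-leaf {u} u<n with u <? n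
  ... | yes _ = refl
  ... | no u≮n = ⊥-elim (u≮n u<n)

  heightₛ-spine : ∀ {u} → n ≤ u → heightₛ u ≡ S ∸ (u ∸ n)
  heightₛ-spine {u} n≤u with u <? n
  ... | yes u<n = ⊥-elim (<⇒≱ u<n n≤u)
  ... | no _ = refl

  LeafEdge⇒height₀ : ∀ {t v} → LeafEdge t v → height₀ t ≡ suc (height₀ v)
  LeafEdge⇒height₀ {t} (t<n , refl) =
    trans (height₀-leaf t<n) (cong suc (sym (trans (height₀-spine (m≤m+n n _)) (m+n∸m≡n n (attach t)))))

  SpineEdge⇒height₀ : ∀ {u v} → SpineEdge u v → height₀ v ≡ suc (height₀ u)
  SpineEdge⇒height₀ {u} (n≤u , refl) =
    trans (height₀-spine (≤-trans n≤u (n≤1+n u))) (trans (+-∸-assoc 1 n≤u) (cong suc (sym (height₀-spine n≤u))))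

  LeafEdge⇒heightₛ : ∀ {t v} → LeafEdge t v → heightₛ t ≡ suc (heightₛ v)
  LeafEdge⇒heightₛ {t} (t<n , refl) =
    trans (heightₛ-leaf t<n) (cong suc (sym (trans (heightₛ-spine (m≤m+n n _)) (cong (S ∸_) (m+n∸m≡n n (attach t))))))

  SpineEdge⇒heightₛ : ∀ {u v} → v < m → SpineEdge u v → heightₛ u ≡ suc (heightₛ v)
  SpineEdge⇒heightₛ {u} v<m (n≤u , refl) = begin
    heightₛ u ≡⟨ heightₛ-spine n≤u ⟩
    S ∸ (u ∸ n) ≡⟨ +-∸-assoc 1 u∸n<S ⟩
    suc (S ∸ suc (u ∸ n)) ≡⟨ cong (λ t → suc (S ∸ t)) (+-∸-assoc 1 n≤u) ⟨
    suc (S ∸ (suc u ∸ n)) ≡⟨ cong suc (heightₛ-spine (≤-trans n≤u (n≤1+n u))) ⟨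
    suc (heightₛ (suc u)) ∎
    where
    open ≡-Reasoning
    u∸n<S : suc (u ∸ n) ≤ S
    u∸n<S = ≤-pred (+-cancelˡ-≤ n _ _ (≤-trans (≤-reflexive (trans (+-suc n (suc (u ∸ n)))
              (cong suc (trans (+-suc n (u ∸ n)) (cong suc (m+[n∸m]≡n n≤u)))))) v<m))

  Edge⇒height₀-step : ∀ {u v} → Edge u v → height₀ v ≡ suc (height₀ u) ⊎ height₀ u ≡ suc (height₀ v)
  Edge⇒height₀-step (inj₁ e) = inj₂ (LeafEdge⇒height₀ e)
  Edge⇒height₀-step (inj₂ (inj₁ e)) = inj₁ (LeafEdge⇒height₀ e)
  Edge⇒height₀-step (inj₂ (inj₂ (inj₁ e))) = inj₁ (SpineEdge⇒height₀ e)
  Edge⇒height₀-step (inj₂ (inj₂ (inj₂ e))) = inj₂ (SpineEdge⇒height₀ e)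

  Edge⇒heightₛ-step : ∀ {u v} → u < m → v < m → Edge u v → heightₛ v ≡ suc (heightₛ u) ⊎ heightₛ u ≡ suc (heightₛ v)
  Edge⇒heightₛ-step _ _ (inj₁ e) = inj₂ (LeafEdge⇒heightₛ e)
  Edge⇒heightₛ-step _ _ (inj₂ (inj₁ e)) = inj₁ (LeafEdge⇒heightₛ e)
  Edge⇒heightₛ-step _ v<m (inj₂ (inj₂ (inj₁ e))) = inj₂ (SpineEdge⇒heightₛ v<m e)
  Edge⇒heightₛ-step u<m _ (inj₂ (inj₂ (inj₂ e))) = inj₁ (SpineEdge⇒heightₛ u<m e)

  private
    ≡suc⇒≮ : ∀ {a b} → a ≡ suc b → ¬ a < b
    ≡suc⇒≮ a≡1+b a<b = <-asym a<b (≤-reflexive (sym a≡1+b))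

  lower₀ : ∀ {u a} → Edge u a → height₀ a < height₀ u → LeafEdge u a ⊎ SpineEdge a u
  lower₀ (inj₁ e) _ = inj₁ e
  lower₀ (inj₂ (inj₁ e)) a<u = ⊥-elim (≡suc⇒≮ (LeafEdge⇒height₀ e) a<u)
  lower₀ (inj₂ (inj₂ (inj₁ e))) a<u = ⊥-elim (≡suc⇒≮ (SpineEdge⇒height₀ e) a<u)
  lower₀ (inj₂ (inj₂ (inj₂ e))) _ = inj₂ e

  lowerₛ : ∀ {u a} → u < m → Edge u a → heightₛ a < heightₛ u → LeafEdge u a ⊎ SpineEdge u a
  lowerₛ _ (inj₁ e) _ = inj₁ e
  lowerₛ _ (inj₂ (inj₁ e)) a<u = ⊥-elim (≡suc⇒≮ (LeafEdge⇒heightₛ e) a<u)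
  lowerₛ _ (inj₂ (inj₂ (inj₁ e))) _ = inj₂ e
  lowerₛ u<m (inj₂ (inj₂ (inj₂ e))) a<u = ⊥-elim (≡suc⇒≮ (SpineEdge⇒heightₛ u<m e) a<u)

  lower-unique₀ : ∀ {u a b} → Edge u a → Edge u b → height₀ a < height₀ u → height₀ b < height₀ u → a ≡ b
  lower-unique₀ {u} {a} {b} u∼a u∼b a<u b<u with lower₀ u∼a a<u | lower₀ u∼b b<u
  ... | inj₁ (_ , a≡) | inj₁ (_ , b≡) = trans a≡ (sym b≡)
  ... | inj₂ (_ , 1+a≡u) | inj₂ (_ , 1+b≡u) = suc-injective (trans 1+a≡u (sym 1+b≡u))
  ... | inj₁ (u<n , _) | inj₂ (n≤b , refl) = ⊥-elim (<⇒≱ u<n (≤-trans n≤b (n≤1+n b)))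
  ... | inj₂ (n≤a , refl) | inj₁ (u<n , _) = ⊥-elim (<⇒≱ u<n (≤-trans n≤a (n≤1+n a)))

  lower-uniqueₛ : ∀ {u a b} → u < m → Edge u a → Edge u b → heightₛ a < heightₛ u → heightₛ b < heightₛ u → a ≡ b
  lower-uniqueₛ u<m u∼a u∼b a<u b<u with lowerₛ u<m u∼a a<u | lowerₛ u<m u∼b b<u
  ... | inj₁ (_ , a≡) | inj₁ (_ , b≡) = trans a≡ (sym b≡)
  ... | inj₂ (_ , 1+u≡a) | inj₂ (_ , 1+u≡b) = trans (sym 1+u≡a) 1+u≡b
  ... | inj₁ (u<n , _) | inj₂ (n≤u , _) = ⊥-elim (<⇒≱ u<n n≤u)
  ... | inj₂ (n≤u , _) | inj₁ (u<n , _) = ⊥-elim (<⇒≱ u<n n≤u)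

  Neighbours₃ : ℕ → ℕ → ℕ → ℕ → Set
  Neighbours₃ u a b c = (a < m × b < m × c < m) × (a ≢ b × a ≢ c × b ≢ c) × (Edge u a × Edge u b × Edge u c) ×
                        (∀ v → v < m → Edge u v → v ≡ a ⊎ v ≡ b ⊎ v ≡ c)

  n<m : n < m
  n<m = m<m+n n (s≤s z≤n)

  n+j<m : ∀ {j} → j ≤ S → n + j < m
  n+j<m j≤S = ≤-trans (≤-reflexive (sym (+-suc n _))) (+-monoʳ-≤ n (s≤s j≤S))

  first-spine-neighbours : Neighbours₃ (n + 0) 0 1 (suc n)
  first-spine-neighbours =
    (<-trans (s≤s z≤n) n<m , <-trans (s≤s (s≤s z≤n)) n<m , subst (_< m) (+-comm n 1) (n+j<m (s≤s z≤n))) ,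
    ((λ ()) , (λ ()) , (λ ())) ,
    (inj₂ (inj₁ (s≤s z≤n , refl)) , inj₂ (inj₁ (s≤s (s≤s z≤n) , refl)) ,
     inj₂ (inj₂ (inj₁ (m≤m+n n 0 , cong suc (+-identityʳ n))))) ,
    neighbours
    where
    neighbours : ∀ v → v < m → Edge (n + 0) v → v ≡ 0 ⊎ v ≡ 1 ⊎ v ≡ suc n
    neighbours v _ e with Edge-from-spine (m≤m+n n 0) e
    ... | inj₁ (_ , n+0≡) = [ inj₁ , (λ v≡1 → inj₂ (inj₁ v≡1)) ]′ (attach≡0⇒ v (sym (+-cancelˡ-≡ n _ _ n+0≡)))
    ... | inj₂ (inj₁ 1+n+0≡v) = inj₂ (inj₂ (trans (sym 1+n+0≡v) (cong suc (+-identityʳ n))))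
    ... | inj₂ (inj₂ (n≤v , 1+v≡n+0)) = ⊥-elim (<⇒≱ (≤-trans (s≤s n≤v) (≤-reflexive (trans 1+v≡n+0 (+-identityʳ n)))) ≤-refl)

  last-spine-neighbours : Neighbours₃ (n + S) (suc S) (suc (suc S)) (n + d)
  last-spine-neighbours =
    (≤-trans (n≤1+n _) (≤-trans (n≤1+n _) n<m) , ≤-trans (n≤1+n _) n<m , n+j<m (n≤1+n d)) ,
    (<⇒≢ (n<1+n (suc S)) , <⇒≢ (<-≤-trans (n≤1+n (suc (suc S))) (m≤m+n n d)) , <⇒≢ (<-≤-trans ≤-refl (m≤m+n n d))) ,
    (inj₂ (inj₁ (≤-trans (n≤1+n _) (n<1+n _) , cong (n +_) (sym (⊓-idem S)))) ,
     inj₂ (inj₁ (n<1+n _ , cong (n +_) (sym (m≥n⇒m⊓n≡n (n≤1+n S))))) ,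
     inj₂ (inj₂ (inj₂ (m≤m+n n d , sym (+-suc n d))))) ,
    neighbours
    where
    neighbours : ∀ v → v < m → Edge (n + S) v → v ≡ suc S ⊎ v ≡ suc (suc S) ⊎ v ≡ n + d
    neighbours v v<m e with Edge-from-spine (m≤m+n n S) e
    ... | inj₁ (v<n , n+S≡) = [ inj₁ , (λ v≡ → inj₂ (inj₁ v≡)) ]′ (attach≡S⇒ v v<n (sym (+-cancelˡ-≡ n _ _ n+S≡)))
    ... | inj₂ (inj₁ 1+n+S≡v) = ⊥-elim (<-irrefl (trans (sym 1+n+S≡v) (sym (+-suc n S))) v<m)
    ... | inj₂ (inj₂ (_ , 1+v≡n+S)) = inj₂ (inj₂ (suc-injective (trans 1+v≡n+S (+-suc n d))))

  inner-spine-neighbours : ∀ {j} → suc j < S → Neighbours₃ (n + suc j) (suc (suc j)) (suc (n + suc j)) (n + j)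
  inner-spine-neighbours {j} 1+j<S =
    (<-trans 2+j<n n<m , ≤-trans (≤-reflexive (cong suc (sym (+-suc n (suc j))))) (n+j<m 1+j<S) ,
     n+j<m (≤-trans (n≤1+n j) (<⇒≤ 1+j<S))) ,
    (<⇒≢ (<-≤-trans 2+j<n (≤-trans (m≤m+n n (suc j)) (n≤1+n _))) , <⇒≢ (<-≤-trans 2+j<n (m≤m+n n j)) ,
     (λ e → <-irrefl (sym e) (s≤s (+-monoʳ-≤ n (n≤1+n j))))) ,
    (inj₂ (inj₁ (2+j<n , cong (n +_) (sym (attach-suc (<⇒≤ 1+j<S))))) ,
     inj₂ (inj₂ (inj₁ (m≤m+n n _ , refl))) ,
     inj₂ (inj₂ (inj₂ (m≤m+n n j , sym (+-suc n j))))) ,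
    neighbours
    where
    2+j<n : suc (suc j) < n
    2+j<n = ≤-trans (s≤s 1+j<S) (≤-trans (n≤1+n (suc S)) (n≤1+n (suc (suc S))))
    neighbours : ∀ v → v < m → Edge (n + suc j) v → v ≡ suc (suc j) ⊎ v ≡ suc (n + suc j) ⊎ v ≡ n + j
    neighbours v _ e with Edge-from-spine (m≤m+n n (suc j)) e
    ... | inj₁ (_ , n+1+j≡) = inj₁ (attach≡inner⇒ v (s≤s z≤n) 1+j<S (sym (+-cancelˡ-≡ n _ _ n+1+j≡)))
    ... | inj₂ (inj₁ 1+n+1+j≡v) = inj₂ (inj₁ (sym 1+n+1+j≡v))
    ... | inj₂ (inj₂ (_ , 1+v≡)) = inj₂ (inj₂ (suc-injective (trans 1+v≡ (+-suc n j))))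

  attach-injective-inner : ∀ {t t′} → 0 < t → 0 < t′ → t ≤ suc S → t′ ≤ suc S → attach t ≡ attach t′ → t ≡ t′
  attach-injective-inner {suc t} {suc t′} _ _ (s≤s t≤S) (s≤s t′≤S) e =
    cong suc (trans (sym (attach-suc t≤S)) (trans e (attach-suc t′≤S)))

  spine-neighbours : ∀ j → j ≤ S → ∃ λ a → ∃ λ b → ∃ λ c → Neighbours₃ (n + j) a b c
  spine-neighbours zero _ = _ , _ , _ , first-spine-neighbours
  spine-neighbours (suc j) 1+j≤S with m≤n⇒m<n∨m≡n 1+j≤S
  ... | inj₁ 1+j<S = _ , _ , _ , inner-spine-neighbours 1+j<S
  ... | inj₂ refl = _ , _ , _ , last-spine-neighbours

module Caterpillar (d : ℕ) (pos : Fin (CaterpillarShape.n d) → ℕ) (pos< : ∀ x → pos x < CaterpillarShape.n d)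
  (pos-injective : ∀ {x y} → pos x ≡ pos y → x ≡ y)
  (pos-surjective : ∀ {t} → t < CaterpillarShape.n d → ∃ λ x → pos x ≡ t) where

  open CaterpillarShape d

  private
    does≡true⇒ : ∀ {P : Set} (P? : Dec P) → does P? ≡ true → P
    does≡true⇒ (yes p) _ = p

  adj : Fin m → Subset m
  adj u = tabulate (λ v → does (Edge? (toℕ u) (toℕ v)))

  open GraphNotions adj
  open Layering adj

  Edge⇒Adj : ∀ u v → Edge (toℕ u) (toℕ v) → Adj u v
  Edge⇒Adj u v e = lookup⇒[]= v (adj u)
    (trans (lookup∘tabulate (λ w → does (Edge? (toℕ u) (toℕ w))) v) (dec-true (Edge? (toℕ u) (toℕ v)) e))

  Adj⇒Edge : ∀ u v → Adj u v → Edge (toℕ u) (toℕ v)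
  Adj⇒Edge u v v∈ = does≡true⇒ (Edge? (toℕ u) (toℕ v))
    (trans (sym (lookup∘tabulate (λ w → does (Edge? (toℕ u) (toℕ w))) v)) ([]=⇒lookup v∈))

  Adj-sym : ∀ u v → Adj u v → Adj v u
  Adj-sym u v u∼v = Edge⇒Adj v u (Edge-sym (Adj⇒Edge u v u∼v))

  Adj-irrefl : ∀ u → u ∉ adj u
  Adj-irrefl u u∼u = Edge-irrefl _ (Adj⇒Edge u u u∼u)

  h₀ hₛ : Fin m → ℕ
  h₀ u = height₀ (toℕ u)
  hₛ u = heightₛ (toℕ u)

  h₀-step : ∀ u v → Adj u v → h₀ v ≡ suc (h₀ u) ⊎ h₀ u ≡ suc (h₀ v)
  h₀-step u v u∼v = Edge⇒height₀-step (Adj⇒Edge u v u∼v)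

  hₛ-step : ∀ u v → Adj u v → hₛ v ≡ suc (hₛ u) ⊎ hₛ u ≡ suc (hₛ v)
  hₛ-step u v u∼v = Edge⇒heightₛ-step (toℕ<n u) (toℕ<n v) (Adj⇒Edge u v u∼v)

  h₀-lower-unique : ∀ u a b → Adj u a → Adj u b → h₀ a < h₀ u → h₀ b < h₀ u → a ≡ b
  h₀-lower-unique u a b u∼a u∼b a<u b<u = toℕ-injective (lower-unique₀ (Adj⇒Edge u a u∼a) (Adj⇒Edge u b u∼b) a<u b<u)

  hₛ-lower-unique : ∀ u a b → Adj u a → Adj u b → hₛ a < hₛ u → hₛ b < hₛ u → a ≡ b
  hₛ-lower-unique u a b u∼a u∼b a<u b<u =
    toℕ-injective (lower-uniqueₛ (toℕ<n u) (Adj⇒Edge u a u∼a) (Adj⇒Edge u b u∼b) a<u b<u)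

  module Layered₀ = Layered Adj-sym h₀ h₀-step h₀-lower-unique
  module Layeredₛ = Layered Adj-sym hₛ hₛ-step hₛ-lower-unique

  spine : ∀ j → j ≤ S → Fin m
  spine j j≤S = fromℕ< (n+j<m j≤S)

  toℕ-spine : ∀ j j≤S → toℕ (spine j j≤S) ≡ n + j
  toℕ-spine j j≤S = toℕ-fromℕ< (n+j<m j≤S)

  spine-irrelevant : ∀ j (p q : j ≤ S) → spine j p ≡ spine j q
  spine-irrelevant j p q = toℕ-injective (trans (toℕ-spine j p) (sym (toℕ-spine j q)))

  leaf : Fin n → Fin m
  leaf x = fromℕ< (<-trans (pos< x) n<m)

  toℕ-leaf : ∀ x → toℕ (leaf x) ≡ pos x
  toℕ-leaf x = toℕ-fromℕ< (<-trans (pos< x) n<m)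

  leaf-injective : ∀ {x y} → leaf x ≡ leaf y → x ≡ y
  leaf-injective {x} {y} e = pos-injective (trans (sym (toℕ-leaf x)) (trans (cong toℕ e) (toℕ-leaf y)))

  vertex-cases : ∀ u → toℕ u < n ⊎ (Σ ℕ λ j → Σ (j ≤ S) λ j≤S → u ≡ spine j j≤S)
  vertex-cases u with toℕ u <? n
  ... | yes u<n = inj₁ u<n
  ... | no u≮n = inj₂ (toℕ u ∸ n , u∸n≤S , toℕ-injective (trans (sym (m+[n∸m]≡n n≤u)) (sym (toℕ-spine _ u∸n≤S))))
    where
    n≤u = ≮⇒≥ u≮n
    u∸n≤S : toℕ u ∸ n ≤ S
    u∸n≤S = ≤-pred (+-cancelˡ-≤ n _ _ (≤-trans (≤-reflexive (trans (+-suc n (toℕ u ∸ n))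
              (cong suc (m+[n∸m]≡n n≤u)))) (toℕ<n u)))

  Adj-spine-suc : ∀ j (1+j≤S : suc j ≤ S) → Adj (spine j (≤-trans (n≤1+n j) 1+j≤S)) (spine (suc j) 1+j≤S)
  Adj-spine-suc j 1+j≤S = Edge⇒Adj _ _ (inj₂ (inj₂ (inj₁
    (subst (n ≤_) (sym (toℕ-spine j j≤S)) (m≤m+n n j) ,
     trans (cong suc (toℕ-spine j j≤S)) (trans (sym (+-suc n j)) (sym (toℕ-spine (suc j) 1+j≤S)))))))
    where j≤S = ≤-trans (n≤1+n j) 1+j≤S

  Adj-leaf-spine : ∀ u (u<n : toℕ u < n) → Adj u (spine (attach (toℕ u)) (attach≤S (toℕ u)))
  Adj-leaf-spine u u<n = Edge⇒Adj _ _ (inj₁ (u<n , toℕ-spine _ (attach≤S (toℕ u))))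

  root : Fin m
  root = spine 0 z≤n

  spine-to-root : ∀ j j≤S → ∃ λ vs → Walk (spine j j≤S) root vs
  spine-to-root zero 0≤S = _ , subst (λ t → Walk t root (t ∷ [])) (spine-irrelevant 0 z≤n 0≤S) (here root)
  spine-to-root (suc j) 1+j≤S = _ , step (Adj-sym _ _ (Adj-spine-suc j 1+j≤S)) (proj₂ (spine-to-root j (≤-trans (n≤1+n j) 1+j≤S)))

  to-root : ∀ u → ∃ λ vs → Walk u root vs
  to-root u with vertex-cases u
  ... | inj₁ u<n = _ , step (Adj-leaf-spine u u<n) (proj₂ (spine-to-root _ (attach≤S (toℕ u))))
  ... | inj₂ (j , j≤S , refl) = spine-to-root j j≤S

  connected : Connected
  connected u v = Walk-++ (proj₂ (to-root u)) (proj₂ (Walk-reverse Adj-sym (proj₂ (to-root v))))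

  vertex : ∀ {t} → t < m → Fin m
  vertex t<m = fromℕ< t<m

  ≡vertex : ∀ {v t} (t<m : t < m) → toℕ v ≡ t → v ≡ vertex t<m
  ≡vertex t<m v≡t = toℕ-injective (trans v≡t (sym (toℕ-fromℕ< t<m)))

  ∈adj : ∀ u {t} (t<m : t < m) → Edge (toℕ u) t → vertex t<m ∈ adj u
  ∈adj u t<m e = Edge⇒Adj u _ (subst (Edge (toℕ u)) (sym (toℕ-fromℕ< t<m)) e)

  unique-neighbour⇒deg≡1 : ∀ u {a} (a<m : a < m) → Edge (toℕ u) a → (∀ v → Edge (toℕ u) v → v ≡ a) → deg u ≡ 1
  unique-neighbour⇒deg≡1 u a<m u∼a only = trans (cong ∣_∣ adj≡) (∣⁅x⁆∣≡1 (vertex a<m))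
    where
    adj≡ : adj u ≡ ⁅ vertex a<m ⁆
    adj≡ = ⊆-antisym
      (λ {v} v∈ → subst (_∈ ⁅ vertex a<m ⁆) (sym (≡vertex a<m (only (toℕ v) (Adj⇒Edge u v v∈)))) (x∈⁅x⁆ _))
      (λ {v} v∈ → subst (_∈ adj u) (sym (x∈⁅y⁆⇒x≡y _ v∈)) (∈adj u a<m u∼a))

  Neighbours₃⇒deg≡3 : ∀ u {a b c} → Neighbours₃ (toℕ u) a b c → deg u ≡ 3
  Neighbours₃⇒deg≡3 u {a} {b} {c} ((a<m , b<m , c<m) , (a≢b , a≢c , b≢c) , (u∼a , u∼b , u∼c) , only) =
    ≤-antisym (≤-trans (p⊆q⇒∣p∣≤∣q∣ adj⊆) (≤-trans (∣p∪⁅x⁆∣≤1+∣p∣ (⁅ va ⁆ ∪ ⁅ vb ⁆) vc) (s≤s (∣⁅x⁆∪⁅y⁆∣≤2 va vb))))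
              (∈∧∈∧∈∧≢⇒3≤∣p∣ (∈adj u a<m u∼a) (∈adj u b<m u∼b) (∈adj u c<m u∼c)
                 (vertex-≢ a<m b<m a≢b) (vertex-≢ a<m c<m a≢c) (vertex-≢ b<m c<m b≢c))
    where
    va = vertex a<m
    vb = vertex b<m
    vc = vertex c<m
    vertex-≢ : ∀ {t t′} (t<m : t < m) (t′<m : t′ < m) → t ≢ t′ → vertex t<m ≢ vertex t′<m
    vertex-≢ t<m t′<m t≢t′ e = t≢t′ (trans (sym (toℕ-fromℕ< t<m)) (trans (cong toℕ e) (toℕ-fromℕ< t′<m)))
    adj⊆ : adj u ⊆ (⁅ va ⁆ ∪ ⁅ vb ⁆) ∪ ⁅ vc ⁆
    adj⊆ {v} v∈ with only (toℕ v) (toℕ<n v) (Adj⇒Edge u v v∈)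
    ... | inj₁ v≡a = x∈p∪q⁺ (inj₁ (x∈p∪q⁺ (inj₁ (subst (_∈ ⁅ va ⁆) (sym (≡vertex a<m v≡a)) (x∈⁅x⁆ va)))))
    ... | inj₂ (inj₁ v≡b) = x∈p∪q⁺ (inj₁ (x∈p∪q⁺ (inj₂ (subst (_∈ ⁅ vb ⁆) (sym (≡vertex b<m v≡b)) (x∈⁅x⁆ vb)))))
    ... | inj₂ (inj₂ v≡c) = x∈p∪q⁺ (inj₂ (subst (_∈ ⁅ vc ⁆) (sym (≡vertex c<m v≡c)) (x∈⁅x⁆ vc)))

  deg-leaf : ∀ u → toℕ u < n → deg u ≡ 1
  deg-leaf u u<n = unique-neighbour⇒deg≡1 u (n+j<m (attach≤S (toℕ u))) (inj₁ (u<n , refl)) (λ v → Edge-from-leaf u<n)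

  deg-spine : ∀ j j≤S → deg (spine j j≤S) ≡ 3
  deg-spine j j≤S with spine-neighbours j j≤S
  ... | a , b , c , neighbours = Neighbours₃⇒deg≡3 _ (subst (λ t → Neighbours₃ t a b c) (sym (toℕ-spine j j≤S)) neighbours)

  toℕ-leaf<n : ∀ x → toℕ (leaf x) < n
  toℕ-leaf<n x = subst (_< n) (sym (toℕ-leaf x)) (pos< x)

  tree : BinaryPhyloTree n
  tree = record
    { m = m ; adj = adj ; adj-sym = Adj-sym ; irrefl = Adj-irrefl ; connected = connected ; acyclic = Layered₀.acyclic
    ; leaf = leaf ; leaf-inj = leaf-injective ; leaf-deg = λ x → deg-leaf (leaf x) (toℕ-leaf<n x)
    ; deg1-leaf = deg≡1⇒leaf ; binary = binary }
    where
    deg≡1⇒leaf : ∀ v → deg v ≡ 1 → ∃ λ x → leaf x ≡ v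
    deg≡1⇒leaf v deg≡1 with vertex-cases v
    ... | inj₁ v<n = let (x , pos≡) = pos-surjective v<n in x , toℕ-injective (trans (toℕ-leaf x) pos≡)
    ... | inj₂ (j , j≤S , refl) with () ← trans (sym (deg-spine j j≤S)) deg≡1
    binary : ∀ v → deg v ≢ 1 → deg v ≡ 3
    binary v deg≢1 with vertex-cases v
    ... | inj₁ v<n = ⊥-elim (deg≢1 (deg-leaf v v<n))
    ... | inj₂ (j , j≤S , refl) = deg-spine j j≤S

  Adj-leaf⇒ : ∀ w x → Adj w (leaf x) → toℕ w ≡ n + attach (pos x)
  Adj-leaf⇒ w x w∼x = subst (λ t → toℕ w ≡ n + attach t) (toℕ-leaf x)
    (Edge-from-leaf (toℕ-leaf<n x) (Adj⇒Edge (leaf x) w (Adj-sym w (leaf x) w∼x)))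

  at : ∀ {t} → t < n → Fin n
  at t<n = proj₁ (pos-surjective t<n)

  cherry-at : ∀ {t t′} → t < n → t′ < n → Subset n
  cherry-at t<n t′<n = ⁅ at t<n ⁆ ∪ ⁅ at t′<n ⁆

  ≡cherry-at : ∀ {t t′} (t<n : t < n) (t′<n : t′ < n) c → ∣ c ∣ ≡ 2 →
               (∀ x → x ∈ c → pos x ≡ t ⊎ pos x ≡ t′) → c ≡ cherry-at t<n t′<n
  ≡cherry-at t<n t′<n c ∣c∣≡2 positions =
    p⊆q⇒∣q∣≤∣p∣⇒p≡q c⊆ (≤-trans (∣⁅x⁆∪⁅y⁆∣≤2 (at t<n) (at t′<n)) (≤-reflexive (sym ∣c∣≡2)))
    where
    c⊆ : c ⊆ cherry-at t<n t′<n
    c⊆ {x} x∈c with positions x x∈c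
    ... | inj₁ pos≡t = x∈p∪q⁺ (inj₁ (subst (_∈ ⁅ at t<n ⁆) (pos-injective (trans (proj₂ (pos-surjective t<n)) (sym pos≡t))) (x∈⁅x⁆ _)))
    ... | inj₂ pos≡t′ = x∈p∪q⁺ (inj₂ (subst (_∈ ⁅ at t′<n ⁆) (pos-injective (trans (proj₂ (pos-surjective t′<n)) (sym pos≡t′))) (x∈⁅x⁆ _)))

  first-cherry last-cherry : Subset n
  first-cherry = cherry-at {0} (s≤s z≤n) (s≤s (s≤s z≤n))
  last-cherry = cherry-at {suc S} (n≤1+n (suc (suc S))) ≤-refl

  Cherry⇒same-attach : ∀ {c x z} → Cherry tree c → x ∈ c → z ∈ c → attach (pos x) ≡ attach (pos z)
  Cherry⇒same-attach {x = x} {z} (_ , w , w∼c) x∈c z∈c =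
    +-cancelˡ-≡ n _ _ (trans (sym (Adj-leaf⇒ w x (w∼c x x∈c))) (Adj-leaf⇒ w z (w∼c z z∈c)))

  cherries : ∀ c → Cherry tree c → c ≡ first-cherry ⊎ c ≡ last-cherry
  cherries c cherry with 2≤∣p∣⇒∃₂≢ c (≤-reflexive (sym (proj₁ cherry)))
  ... | x , y , x∈c , y∈c , x≢y =
    [ (λ attach≡0 → inj₁ (≡cherry-at _ _ c (proj₁ cherry) λ z z∈c →
        attach≡0⇒ (pos z) (trans (sym (Cherry⇒same-attach cherry x∈c z∈c)) attach≡0))) ,
      (λ attach≡S → inj₂ (≡cherry-at _ _ c (proj₁ cherry) λ z z∈c →
        attach≡S⇒ (pos z) (pos< z) (trans (sym (Cherry⇒same-attach cherry x∈c z∈c)) attach≡S))) ]′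
    (attach-collision (pos x) (pos y) (λ e → x≢y (pos-injective e)) (Cherry⇒same-attach cherry x∈c y∈c))

  caterpillar : Caterpillar tree
  caterpillar (c₁ , c₂ , c₃ , cherry₁ , cherry₂ , cherry₃ , c₁≢c₂ , c₁≢c₃ , c₂≢c₃) =
    [ c₁≢c₂ , [ c₁≢c₃ , c₂≢c₃ ]′ ]′ (pigeonhole (cherries c₁ cherry₁) (cherries c₂ cherry₂) (cherries c₃ cherry₃))
    where
    pigeonhole : ∀ {A : Set} {a b x y z : A} → x ≡ a ⊎ x ≡ b → y ≡ a ⊎ y ≡ b → z ≡ a ⊎ z ≡ b →
                 x ≡ y ⊎ x ≡ z ⊎ y ≡ z
    pigeonhole (inj₁ refl) (inj₁ refl) _ = inj₁ refl
    pigeonhole (inj₂ refl) (inj₂ refl) _ = inj₁ refl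
    pigeonhole (inj₁ refl) (inj₂ refl) (inj₁ refl) = inj₂ (inj₁ refl)
    pigeonhole (inj₁ refl) (inj₂ refl) (inj₂ refl) = inj₂ (inj₂ refl)
    pigeonhole (inj₂ refl) (inj₁ refl) (inj₁ refl) = inj₂ (inj₂ refl)
    pigeonhole (inj₂ refl) (inj₁ refl) (inj₂ refl) = inj₂ (inj₁ refl)

  -- Together, the two halves say that w lies between the leaves at positions a ≤ b;
  -- each half is closed under moving down in h₀ resp. hₛ.
  Span₀ Spanₛ : ℕ → ℕ → Fin m → Set
  Span₀ a b w = (toℕ w < n → toℕ w ≡ a ⊎ toℕ w ≡ b) × (n ≤ toℕ w → toℕ w ∸ n ≤ attach b)
  Spanₛ a b w = (toℕ w < n → toℕ w ≡ a ⊎ toℕ w ≡ b) × (n ≤ toℕ w → attach a ≤ toℕ w ∸ n)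

  private
    n+t∸n≡t : ∀ {v t} → v ≡ n + t → v ∸ n ≡ t
    n+t∸n≡t {t = t} refl = m+n∸m≡n n t

    spine-code≮n : ∀ {v t} → v ≡ n + t → ¬ v < n
    spine-code≮n v≡ v<n = <⇒≱ v<n (≤-trans (m≤m+n n _) (≤-reflexive (sym v≡)))

  Span₀-DownClosed : ∀ {a b} → a ≤ b → Layered₀.DownClosed (Span₀ a b)
  Span₀-DownClosed {a} {b} a≤b u w u∼w w<u (leafs , spines) with lower₀ (Adj⇒Edge u w u∼w) w<u
  ... | inj₁ (u<n , w≡) = (λ w<n → ⊥-elim (spine-code≮n w≡ w<n)) , λ _ →
        subst (_≤ attach b) (sym (n+t∸n≡t w≡)) ([ (λ u≡a → subst (λ t → attach t ≤ attach b) (sym u≡a) (attach-mono a≤b)) ,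
                                                  (λ u≡b → ≤-reflexive (cong attach u≡b)) ]′ (leafs u<n))
  ... | inj₂ (n≤w , 1+w≡u) = (λ w<n → ⊥-elim (<⇒≱ w<n n≤w)) , λ _ →
        ≤-trans (∸-monoˡ-≤ n (≤-trans (n≤1+n _) (≤-reflexive 1+w≡u))) (spines (≤-trans n≤w (≤-trans (n≤1+n _) (≤-reflexive 1+w≡u))))

  Spanₛ-DownClosed : ∀ {a b} → a ≤ b → Layeredₛ.DownClosed (Spanₛ a b)
  Spanₛ-DownClosed {a} {b} a≤b u w u∼w w<u (leafs , spines) with lowerₛ (toℕ<n u) (Adj⇒Edge u w u∼w) w<u
  ... | inj₁ (u<n , w≡) = (λ w<n → ⊥-elim (spine-code≮n w≡ w<n)) , λ _ →
        subst (attach a ≤_) (sym (n+t∸n≡t w≡)) ([ (λ u≡a → ≤-reflexive (cong attach (sym u≡a))) ,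
                                                  (λ u≡b → subst (λ t → attach a ≤ attach t) (sym u≡b) (attach-mono a≤b)) ]′ (leafs u<n))
  ... | inj₂ (n≤u , 1+u≡w) = (λ w<n → ⊥-elim (<⇒≱ w<n (≤-trans n≤u (≤-trans (n≤1+n _) (≤-reflexive 1+u≡w))))) , λ _ →
        ≤-trans (spines n≤u) (∸-monoˡ-≤ n (≤-trans (n≤1+n _) (≤-reflexive 1+u≡w)))

  OnPath⇒between : ∀ {x y w} → pos x ≤ pos y → OnPath (leaf x) (leaf y) w →
                   (toℕ w < n → toℕ w ≡ pos x ⊎ toℕ w ≡ pos y) ×
                   (n ≤ toℕ w → attach (pos x) ≤ toℕ w ∸ n × toℕ w ∸ n ≤ attach (pos y))
  OnPath⇒between {x} {y} {w} x≤y (vs , (W , unique) , w∈) =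
    proj₁ span₀ , λ n≤w → proj₂ spanₛ n≤w , proj₂ span₀ n≤w
    where
    leaf∉spine : ∀ z → ¬ n ≤ toℕ (leaf z)
    leaf∉spine z = <⇒≱ (toℕ-leaf<n z)
    span₀ : Span₀ (pos x) (pos y) w
    span₀ = Layered₀.Path-DownClosed (Span₀-DownClosed x≤y) W unique
      ((λ _ → inj₁ (toℕ-leaf x)) , λ n≤ → ⊥-elim (leaf∉spine x n≤))
      ((λ _ → inj₂ (toℕ-leaf y)) , λ n≤ → ⊥-elim (leaf∉spine y n≤)) w w∈
    spanₛ : Spanₛ (pos x) (pos y) w
    spanₛ = Layeredₛ.Path-DownClosed (Spanₛ-DownClosed x≤y) W unique
      ((λ _ → inj₁ (toℕ-leaf x)) , λ n≤ → ⊥-elim (leaf∉spine x n≤))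
      ((λ _ → inj₂ (toℕ-leaf y)) , λ n≤ → ⊥-elim (leaf∉spine y n≤)) w w∈

  median-position : ∀ {x y z w} → pos x < pos y → pos y < pos z →
                    OnPath (leaf x) (leaf y) w → OnPath (leaf y) (leaf z) w → OnPath (leaf x) (leaf z) w →
                    toℕ w ≡ n + attach (pos y)
  median-position {x} {y} {z} {w} x<y y<z xy yz xz with toℕ w <? n
  ... | yes w<n = ⊥-elim (distinct (proj₁ (OnPath⇒between (<⇒≤ x<y) xy) w<n) (proj₁ (OnPath⇒between (<⇒≤ y<z) yz) w<n)
                                   (proj₁ (OnPath⇒between (<⇒≤ (<-trans x<y y<z)) xz) w<n))
    where
    distinct : toℕ w ≡ pos x ⊎ toℕ w ≡ pos y → toℕ w ≡ pos y ⊎ toℕ w ≡ pos z → toℕ w ≡ pos x ⊎ toℕ w ≡ pos z → ⊥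
    distinct (inj₁ w≡x) (inj₁ w≡y) _ = <-irrefl (trans (sym w≡x) w≡y) x<y
    distinct (inj₁ w≡x) (inj₂ w≡z) _ = <-irrefl (trans (sym w≡x) w≡z) (<-trans x<y y<z)
    distinct (inj₂ w≡y) _ (inj₁ w≡x) = <-irrefl (trans (sym w≡x) w≡y) x<y
    distinct (inj₂ w≡y) _ (inj₂ w≡z) = <-irrefl (trans (sym w≡y) w≡z) y<z
  ... | no w≮n = trans (sym (m+[n∸m]≡n n≤w)) (cong (n +_) (≤-antisym
        (proj₂ (proj₂ (OnPath⇒between (<⇒≤ x<y) xy) n≤w)) (proj₁ (proj₂ (OnPath⇒between (<⇒≤ y<z) yz) n≤w))))
    where n≤w = ≮⇒≥ w≮n

-- Medians in the caterpillar of an arrangement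

module _ (d k : ℕ) (τ : Fin k → Subset (CaterpillarShape.n d)) (∣τ∣≡3 : ∀ i → ∣ τ i ∣ ≡ 3) (thin : Thin τ)
         (arr : Ordering.Arrangement τ ∣τ∣≡3 thin ⊤) where

  open CaterpillarShape d
  open Ordering τ ∣τ∣≡3 thin
  open Arrangement arr
  open ListPosition (_≟F_ {n})

  ∈order : ∀ x → x ∈ₗ order
  ∈order x = complete (∈⊤ {x = x})

  length-order≡n : length order ≡ n
  length-order≡n = trans length≡ (∣⊤∣≡n n)

  pos : Fin n → ℕ
  pos x = position x order

  pos< : ∀ x → pos x < n
  pos< x = subst (pos x <_) length-order≡n (position-< order (∈order x))

  pos-injective : ∀ {x y} → pos x ≡ pos y → x ≡ y
  pos-injective {x} {y} = position-injective order (∈order x) (∈order y)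

  pos-surjective : ∀ {t} → t < n → ∃ λ x → pos x ≡ t
  pos-surjective {t} t<n with position-surjective order unique (subst (t <_) (sym length-order≡n) t<n)
  ... | x , _ , pos≡t = x , pos≡t

  open Caterpillar d pos pos< pos-injective pos-surjective

  sort₃ : ∀ s → ∣ s ∣ ≡ 3 → ∃ λ x → ∃ λ y → ∃ λ z → x ∈ s × y ∈ s × z ∈ s × pos x < pos y × pos y < pos z
  sort₃ s ∣s∣≡3 =
    let (_ , _ , _ , a∈ , b∈ , c∈ , a≢b , a≢c , b≢c) = ∣p∣≡3⇒∃₃≢ s ∣s∣≡3
    in sort-distinct pos pos-injective {P = _∈ s} a∈ b∈ c∈ a≢b a≢c b≢c

  -- The median of a triple is the spine vertex of its middle leaf, which never
  -- sits at one of the extreme positions 0 or S + 2.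
  IsMed⇒middle : ∀ i v → IsMed tree (τ i) v →
                 ∃ λ y → MiddleIn ⊤ order (τ i) y × 0 < pos y × pos y ≤ suc S × toℕ v ≡ n + attach (pos y)
  IsMed⇒middle i v med =
    let (x , y , z , x∈ , y∈ , z∈ , x<y , y<z) = sort₃ (τ i) (∣τ∣≡3 i) in
    y , (y∈ , (x , x∈ , inj₂ (precedes x<y)) , (z , z∈ , precedes y<z)) ,
    ≤-trans (s≤s z≤n) x<y , ≤-pred (≤-pred (≤-trans (s≤s y<z) (pos< z))) ,
    median-position {x} {y} {z} {v} x<y y<z (med x y x∈ y∈ (<⇒≢ x<y ∘ cong pos)) (med y z y∈ z∈ (<⇒≢ y<z ∘ cong pos))
                            (med x z x∈ z∈ (<⇒≢ (<-trans x<y y<z) ∘ cong pos))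
    where
    precedes : ∀ {a b} → pos a < pos b → Precedes order a b
    precedes {a} {b} = position-<⇒Precedes order (∈order a) (∈order b)

  med-injective : MedInjective tree τ
  med-injective i j v med-i med-j =
    let (y , middle-i , 0<y , y≤ , v≡y) = IsMed⇒middle i v med-i
        (y′ , middle-j , 0<y′ , y′≤ , v≡y′) = IsMed⇒middle j v med-j
        y≡y′ = pos-injective (attach-injective-inner 0<y 0<y′ y≤ y′≤ (+-cancelˡ-≡ n _ _ (trans (sym v≡y) v≡y′)))
    in middle-injective i j y middle-i (subst (MiddleIn ⊤ order (τ j)) (sym y≡y′) middle-j)

  caterpillar-with-injective-med : ∃ λ (T : BinaryPhyloTree n) → Caterpillar T × MedInjective T τ
  caterpillar-with-injective-med = tree , caterpillar , med-injective

theorem2 : (n : ℕ) → 4 ≤ n → (k : ℕ) → 1 ≤ k → (τ : Fin k → Subset n) → Injective _≡_ _≡_ τ → (∀ i → ∣ τ i ∣ ≡ 3) → Thin τ → ∃ λ (T : BinaryPhyloTree n) → Caterpillar T × MedInjective T τ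
theorem2 .(suc (suc (suc (suc d)))) (s≤s (s≤s (s≤s (s≤s (z≤n {d}))))) k _ τ _ ∣τ∣≡3 thin =
  caterpillar-with-injective-med d k τ ∣τ∣≡3 thin (Ordering.arrangement τ ∣τ∣≡3 thin)
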